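{- Let $n \in \{1,2,\dots\}$ and let $\pi$ be a uniformly random permutation in $S_n$. For every $k \in [n]$ we have $\mathbf{E}[Z_{n,k}] = \binom{n}{k}/k!$. Moreover, for any $k,\ell \in [n]$, \[ \mathbf{E}[Z_{n,k}Z_{n,\ell}] \,=\, \sum_{j=0}^{k\wedge \ell} \mathbf{E}[Z_{n,k+\ell-j}]\, \mathcal{A}(k-j,\ell-j,j). \]
   Context: $[n]=\{1,\dots,n\}$ and $S_n$ is the set of permutations $\pi=(\pi_1,\dots,\pi_n)$ of $[n]$. For an integer $m\ge 1$, $Z_{n,m}(\pi)=\sum_{1\le i_1<\dots<i_m\le n}\mathbf{1}(\{\pi_{i_1}<\dots<\pi_{i_m}\})$ is the number of increasing subsequences of $\pi$ of length $m$ (this is $0$ when $m>n$). For nonnegative integers $k,\ell,j$, \[ \mathcal{A}(k,\ell,j)=\sum_{\substack{\alpha_0,\dots,\alpha_j\in\{0,1,\dots\}\\ \alpha_0+\dots+\alpha_j=k}}\ \sum_{\substack{\beta_0,\dots,\beta_j\in\{0,1,\dots\}\\ \beta_0+\dots+\beta_j=\ell}}\ \prod_{r=0}^{j}\binom{\alpha_r+\beta_r}{\alpha_r,\beta_r}^2, \] where $\binom{\alpha+\beta}{\alpha,\beta}=\frac{(\alpha+\beta)!}{\alpha!\,\beta!}$. -}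

module Defs where

open import Data.Nat using (ℕ; zero; suc; _+_; _*_; _∸_; _<ᵇ_; _^_)
open import Data.Nat.Combinatorics using (_C_)
open import Data.Bool using (Bool; true; false; if_then_else_)
open import Data.Maybe using (Maybe; just; nothing)
open import Data.Fin using (Fin; toℕ; _≟_)
open import Data.Fin.Properties using (all?)
open import Data.List using (List; []; _∷_; map; concatMap; filter; zipWith; upTo; allFin)
open import Data.Nat.ListAction using (sum; product)
open import Data.Vec using (Vec; toList)
import Data.Vec as V
import Data.List.Relation.Unary.Unique.DecPropositional as UDec
open import Relation.Nullary using (Dec)

allVec : (m n : ℕ) → List (Vec (Fin m) n)
allVec m zero    = V.[] ∷ []
allVec m (suc n) = concatMap (λ x → map (x V.∷_) (allVec m n)) (allFin m)

IsPerm : {n : ℕ} → Vec (Fin n) n → Set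
IsPerm π = UDec.Unique _≟_ (toList π)

isPerm? : {n : ℕ} → (π : Vec (Fin n) n) → Dec (IsPerm π)
isPerm? π = UDec.unique? _≟_ (toList π)

Sym : (n : ℕ) → List (Vec (Fin n) n)
Sym n = filter isPerm? (allVec n n)

sumPerm : (n : ℕ) → (Vec (Fin n) n → ℕ) → ℕ
sumPerm n f = sum (map f (Sym n))

-- incSubseq b m xs = number of length-m subsequences of xs that are strictly
-- increasing and (if b = just v) whose first entry exceeds v.
incSubseq : Maybe ℕ → ℕ → List ℕ → ℕ
incSubseq b       zero    xs       = 1
incSubseq b       (suc m) []       = 0
incSubseq nothing (suc m) (x ∷ xs) = incSubseq (just x) m xs + incSubseq nothing (suc m) xs
incSubseq (just v) (suc m) (x ∷ xs) =
  (if v <ᵇ x then incSubseq (just x) m xs else 0) + incSubseq (just v) (suc m) xs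

Z : {n : ℕ} → ℕ → Vec (Fin n) n → ℕ
Z m π = incSubseq nothing m (toList (V.map toℕ π))

compositions : ℕ → ℕ → List (List ℕ)
compositions zero    zero    = [] ∷ []
compositions zero    (suc s) = []
compositions (suc p) s = concatMap (λ a → map (a ∷_) (compositions p (s ∸ a))) (upTo (suc s))

multinom2 : ℕ → ℕ → ℕ
multinom2 a b = (a + b) C a

𝒜 : ℕ → ℕ → ℕ → ℕ
𝒜 k ℓ j = sum (concatMap (λ α → map (λ β → product (zipWith (λ a b → multinom2 a b ^ 2) α β))
                                     (compositions (suc j) ℓ))
                         (compositions (suc j) k))

{-# OPTIONS --safe #-}
-- A pair of increasing subsequences of π of lengths k and ℓ is recorded by labelling every
-- position N (in neither), I (only in the first), J (only in the second) or B (in both), so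
-- Σ_π Z_k Z_ℓ is the sum, over labellings, of the number of permutations that fit the labelling.
-- Adjacent transpositions of positions permute S_n, so labels that do not interact may be swapped,
-- and an adjacent pair I J splits into B J + B I according to which of its two entries is smaller.
-- Hence the number of permutations fitting a labelling with m labelled positions is n!/m! times
-- its weight, the product over the blocks between consecutive B's of the number of shuffles of
-- the block's I's with its J's. The weights of the labellings with j B's add up to
-- C(n, m) 𝒜(k − j, ℓ − j, j) with m = k + ℓ − j, as both sides obey the same recurrence under removal
-- of the first position. The case ℓ = 0 reads Σ_π Z_m = C(n, m) n!/m!.
module Submission where

open import Defs
open import Data.Nat using (ℕ; zero; suc; pred; _+_; _*_; _∸_; _^_; _≤_; _<_; _⊓_; _<ᵇ_; _!; z≤n; s≤s)
open import Data.Nat.Properties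
open import Data.Nat.Combinatorics using (_C_; nCk+nC[k+1]≡[n+1]C[k+1]; nCn≡1)
open import Data.Nat.ListAction using (sum; product)
open import Data.Nat.ListAction.Properties using (sum-++)
open import Data.Nat.Solver using (module +-*-Solver)
open import Data.Bool using (Bool; true; false; if_then_else_; _∧_; T)
open import Data.Bool.Properties using (∧-comm; ∧-idem; if-eta; if-float; if-swap-then; if-cong; if-cong-then)
open import Data.Unit using (⊤; tt)
open import Data.Empty using (⊥; ⊥-elim)
open import Data.Sum using (_⊎_; inj₁; inj₂)
open import Data.Product using (Σ; _×_; _,_)
open import Data.Maybe using (Maybe; just; nothing)
open import Data.Fin using (Fin; toℕ)
open import Data.Fin.Properties using (toℕ-injective)
open import Data.List using (List; []; _∷_; [_]; _++_; map; concatMap; filter; length; replicate; upTo; applyUpTo; allFin; tabulate; zipWith)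
open import Data.List.Properties
  using (++-assoc; ++-identityʳ; map-++; map-∘; map-cong; map-cong-local; map-upTo; map-tabulate; length-++; length-map; length-++-sucʳ; length-replicate)
open import Data.List.Relation.Unary.All using (All; []; _∷_)
import Data.List.Relation.Unary.All as All
open import Data.List.Relation.Unary.All.Properties using (++⁺)
open import Data.List.Relation.Unary.AllPairs using (AllPairs; []; _∷_)
import Data.List.Relation.Unary.AllPairs as AllPairs
import Data.List.Relation.Unary.AllPairs.Properties as AllPairs
open import Data.Vec using (Vec; toList)
open import Data.Vec.Properties using (toList-map; length-toList)
import Data.Vec as V
open import Relation.Nullary using (does; yes; no)
open import Relation.Unary using (Pred; Decidable)
open import Relation.Binary.Definitions using (tri<; tri≈; tri>)
open import Relation.Binary.PropositionalEquality hiding (J; [_])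
open import Function using (_∘_)
open import Level using (0ℓ)
open ≡-Reasoning
open import Algebra.Properties.CommutativeSemigroup +-commutativeSemigroup using (interchange; x∙yz≈y∙xz)
open import Algebra.Properties.CommutativeSemigroup *-commutativeSemigroup using () renaming (x∙yz≈y∙xz to *-exchange)
open +-*-Solver using (solve; _:+_; _:*_; _:=_; con)

variable
  X Y : Set

-- Finite sums

∑ : List X → (X → ℕ) → ℕ
∑ xs f = sum (map f xs)

syntax ∑ xs (λ x → e) = ∑[ x ∈ xs ] e

∑-cong : ∀ (xs : List X) {f g : X → ℕ} → (∀ x → f x ≡ g x) → ∑ xs f ≡ ∑ xs g
∑-cong xs f≗g = cong sum (map-cong f≗g xs)

∑-cong-All : ∀ {xs : List X} {f g : X → ℕ} → All (λ x → f x ≡ g x) xs → ∑ xs f ≡ ∑ xs g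
∑-cong-All f≗g = cong sum (map-cong-local f≗g)

∑-0 : ∀ (xs : List X) → ∑[ x ∈ xs ] 0 ≡ 0
∑-0 []       = refl
∑-0 (x ∷ xs) = ∑-0 xs

∑-+ : ∀ (xs : List X) (f g : X → ℕ) → ∑[ x ∈ xs ] (f x + g x) ≡ ∑ xs f + ∑ xs g
∑-+ []       f g = refl
∑-+ (x ∷ xs) f g = begin
  f x + g x + ∑[ x ∈ xs ] (f x + g x) ≡⟨ cong (f x + g x +_) (∑-+ xs f g) ⟩
  f x + g x + (∑ xs f + ∑ xs g)       ≡⟨ interchange (f x) (g x) (∑ xs f) (∑ xs g) ⟩
  f x + ∑ xs f + (g x + ∑ xs g)       ∎

∑-*ˡ : ∀ (xs : List X) c (f : X → ℕ) → ∑[ x ∈ xs ] (c * f x) ≡ c * ∑ xs f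
∑-*ˡ []       c f = sym (*-zeroʳ c)
∑-*ˡ (x ∷ xs) c f = trans (cong (c * f x +_) (∑-*ˡ xs c f)) (sym (*-distribˡ-+ c (f x) _))

∑-++ : ∀ (xs ys : List X) (f : X → ℕ) → ∑ (xs ++ ys) f ≡ ∑ xs f + ∑ ys f
∑-++ xs ys f = trans (cong sum (map-++ f xs ys)) (sum-++ (map f xs) (map f ys))

∑-map : ∀ (g : X → Y) (xs : List X) (f : Y → ℕ) → ∑ (map g xs) f ≡ ∑ xs (f ∘ g)
∑-map g xs f = cong sum (sym (map-∘ xs))

∑-concatMap : ∀ (g : X → List Y) (xs : List X) (f : Y → ℕ) →
  ∑ (concatMap g xs) f ≡ ∑[ x ∈ xs ] ∑ (g x) f
∑-concatMap g []       f = refl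
∑-concatMap g (x ∷ xs) f = trans (∑-++ (g x) (concatMap g xs) f) (cong (∑ (g x) f +_) (∑-concatMap g xs f))

sum-concatMap : ∀ (g : X → List ℕ) (xs : List X) → sum (concatMap g xs) ≡ ∑[ x ∈ xs ] sum (g x)
sum-concatMap g []       = refl
sum-concatMap g (x ∷ xs) = trans (sum-++ (g x) (concatMap g xs)) (cong (sum (g x) +_) (sum-concatMap g xs))

∑-comm : ∀ (xs : List X) (ys : List Y) (F : X → Y → ℕ) →
  ∑[ x ∈ xs ] ∑[ y ∈ ys ] F x y ≡ ∑[ y ∈ ys ] ∑[ x ∈ xs ] F x y
∑-comm []       ys F = sym (∑-0 ys)
∑-comm (x ∷ xs) ys F =
  trans (cong (∑ ys (F x) +_) (∑-comm xs ys F)) (sym (∑-+ ys (F x) (λ y → ∑[ x ∈ xs ] F x y)))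

∑-if : ∀ (xs : List X) b (f : X → ℕ) → ∑[ x ∈ xs ] (if b then f x else 0) ≡ (if b then ∑ xs f else 0)
∑-if xs true  f = refl
∑-if xs false f = ∑-0 xs

∑-filter : ∀ {P : Pred X 0ℓ} (P? : Decidable P) (xs : List X) (f : X → ℕ) →
  ∑ (filter P? xs) f ≡ ∑[ x ∈ xs ] (if does (P? x) then f x else 0)
∑-filter P? []       f = refl
∑-filter P? (x ∷ xs) f with does (P? x)
... | true  = cong (f x +_) (∑-filter P? xs f)
... | false = ∑-filter P? xs f

∑-upTo-suc : ∀ m (f : ℕ → ℕ) → ∑ (upTo (suc m)) f ≡ f 0 + ∑ (upTo m) (f ∘ suc)
∑-upTo-suc m f = begin
  sum (map f (upTo (suc m)))       ≡⟨ cong sum (map-upTo f (suc m)) ⟩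
  f 0 + sum (applyUpTo (f ∘ suc) m) ≡⟨ cong (λ xs → f 0 + sum xs) (sym (map-upTo (f ∘ suc) m)) ⟩
  f 0 + ∑ (upTo m) (f ∘ suc)       ∎

-- Adjacent transpositions of positions

values : ∀ {n m} → Vec (Fin n) m → List ℕ
values v = toList (V.map toℕ v)

swapAt : ℕ → List X → List X
swapAt zero    (x ∷ y ∷ xs) = y ∷ x ∷ xs
swapAt (suc p) (x ∷ xs)     = x ∷ swapAt p xs
swapAt _       xs           = xs

swapAtᵛ : ∀ {m} → ℕ → Vec X m → Vec X m
swapAtᵛ zero    (x V.∷ y V.∷ xs) = y V.∷ x V.∷ xs
swapAtᵛ (suc p) (x V.∷ xs)       = x V.∷ swapAtᵛ p xs
swapAtᵛ _       xs               = xs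

toList-swapAt : ∀ {m} p (v : Vec X m) → toList (swapAtᵛ p v) ≡ swapAt p (toList v)
toList-swapAt zero    V.[]            = refl
toList-swapAt zero    (x V.∷ V.[])    = refl
toList-swapAt zero    (x V.∷ y V.∷ v) = refl
toList-swapAt (suc p) V.[]            = refl
toList-swapAt (suc p) (x V.∷ v)       = cong (x ∷_) (toList-swapAt p v)

values-swapAt : ∀ {n m} p (v : Vec (Fin n) m) → values (swapAtᵛ p v) ≡ swapAt p (values v)
values-swapAt zero    V.[]            = refl
values-swapAt zero    (x V.∷ V.[])    = refl
values-swapAt zero    (x V.∷ y V.∷ v) = refl
values-swapAt (suc p) V.[]            = refl
values-swapAt (suc p) (x V.∷ v)       = cong (toℕ x ∷_) (values-swapAt p v)

swapAtᵛ-involutive : ∀ {m} p (v : Vec X m) → swapAtᵛ p (swapAtᵛ p v) ≡ v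
swapAtᵛ-involutive zero    V.[]            = refl
swapAtᵛ-involutive zero    (x V.∷ V.[])    = refl
swapAtᵛ-involutive zero    (x V.∷ y V.∷ v) = refl
swapAtᵛ-involutive (suc p) V.[]            = refl
swapAtᵛ-involutive (suc p) (x V.∷ v)       = cong (x V.∷_) (swapAtᵛ-involutive p v)

All-swapAt : ∀ {P : X → Set} p {xs} → All P xs → All P (swapAt p xs)
All-swapAt zero    {[]}         ps             = ps
All-swapAt zero    {x ∷ []}     ps             = ps
All-swapAt zero    {x ∷ y ∷ xs} (px ∷ py ∷ ps) = py ∷ px ∷ ps
All-swapAt (suc p) {[]}         ps             = ps
All-swapAt (suc p) {x ∷ xs}     (px ∷ ps)      = px ∷ All-swapAt p ps

AllPairs-swapAt : ∀ {R : X → X → Set} → (∀ {x y} → R x y → R y x) →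
  ∀ p {xs} → AllPairs R xs → AllPairs R (swapAt p xs)
AllPairs-swapAt sym-R zero    {[]}         rs                     = rs
AllPairs-swapAt sym-R zero    {x ∷ []}     rs                     = rs
AllPairs-swapAt sym-R zero    {x ∷ y ∷ xs} ((rxy ∷ rx) ∷ ry ∷ rs) = (sym-R rxy ∷ ry) ∷ rx ∷ rs
AllPairs-swapAt sym-R (suc p) {[]}         rs                     = rs
AllPairs-swapAt sym-R (suc p) {x ∷ xs}     (rx ∷ rs)              = All-swapAt p rx ∷ AllPairs-swapAt sym-R p rs

IsPerm-swapAt : ∀ {n} p {π : Vec (Fin n) n} → IsPerm π → IsPerm (swapAtᵛ p π)
IsPerm-swapAt p {π} uniq =
  subst (AllPairs _) (sym (toList-swapAt p π)) (AllPairs-swapAt ≢-sym p uniq)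

isPerm?-swapAt : ∀ {n} p (π : Vec (Fin n) n) → does (isPerm? (swapAtᵛ p π)) ≡ does (isPerm? π)
isPerm?-swapAt p π with isPerm? (swapAtᵛ p π) | isPerm? π
... | yes _  | yes _  = refl
... | no _   | no _   = refl
... | yes σ  | no ¬π  = ⊥-elim (¬π (subst IsPerm (swapAtᵛ-involutive p π) (IsPerm-swapAt p σ)))
... | no ¬σ  | yes π′ = ⊥-elim (¬σ (IsPerm-swapAt p π′))

∑-allVec-suc : ∀ {n m} (g : Vec (Fin n) (suc m) → ℕ) →
  ∑ (allVec n (suc m)) g ≡ ∑[ x ∈ allFin n ] ∑[ v ∈ allVec n m ] g (x V.∷ v)
∑-allVec-suc {n} {m} g = trans (∑-concatMap (λ x → map (x V.∷_) (allVec n m)) (allFin n) g)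
  (∑-cong (allFin n) (λ x → ∑-map (x V.∷_) (allVec n m) g))

∑-allVec-swapAt : ∀ {n} m p (g : Vec (Fin n) m → ℕ) → ∑[ v ∈ allVec n m ] g (swapAtᵛ p v) ≡ ∑ (allVec n m) g
∑-allVec-swapAt zero          zero    g = refl
∑-allVec-swapAt zero          (suc p) g = refl
∑-allVec-swapAt {n} 1         zero    g = ∑-cong (allVec n 1) (λ { (x V.∷ V.[]) → refl })
∑-allVec-swapAt {n} (suc (suc m)) zero g = begin
  ∑[ v ∈ allVec n (2 + m) ] g (swapAtᵛ 0 v)
    ≡⟨ unfold (g ∘ swapAtᵛ 0) ⟩
  ∑[ x ∈ allFin n ] ∑[ y ∈ allFin n ] ∑[ v ∈ allVec n m ] g (y V.∷ x V.∷ v)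
    ≡⟨ ∑-comm (allFin n) (allFin n) (λ x y → ∑[ v ∈ allVec n m ] g (y V.∷ x V.∷ v)) ⟩
  ∑[ y ∈ allFin n ] ∑[ x ∈ allFin n ] ∑[ v ∈ allVec n m ] g (y V.∷ x V.∷ v)
    ≡⟨ unfold g ⟨
  ∑ (allVec n (2 + m)) g ∎
  where
  unfold : ∀ (h : Vec (Fin n) (2 + m) → ℕ) →
    ∑ (allVec n (2 + m)) h ≡ ∑[ x ∈ allFin n ] ∑[ y ∈ allFin n ] ∑[ v ∈ allVec n m ] h (x V.∷ y V.∷ v)
  unfold h = trans (∑-allVec-suc h) (∑-cong (allFin n) (λ x → ∑-allVec-suc (h ∘ (x V.∷_))))
∑-allVec-swapAt {n} (suc m) (suc p) g = begin
  ∑[ v ∈ allVec n (suc m) ] g (swapAtᵛ (suc p) v)             ≡⟨ ∑-allVec-suc (g ∘ swapAtᵛ (suc p)) ⟩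
  ∑[ x ∈ allFin n ] ∑[ v ∈ allVec n m ] g (x V.∷ swapAtᵛ p v) ≡⟨ ∑-cong (allFin n) (λ x → ∑-allVec-swapAt m p (g ∘ (x V.∷_))) ⟩
  ∑[ x ∈ allFin n ] ∑[ v ∈ allVec n m ] g (x V.∷ v)           ≡⟨ ∑-allVec-suc g ⟨
  ∑ (allVec n (suc m)) g                                      ∎

sumPerm≡∑allVec : ∀ {n} (f : Vec (Fin n) n → ℕ) →
  sumPerm n f ≡ ∑[ v ∈ allVec n n ] (if does (isPerm? v) then f v else 0)
sumPerm≡∑allVec {n} f = ∑-filter isPerm? (allVec n n) f

sumPerm-swapAt : ∀ n p (f : Vec (Fin n) n → ℕ) → sumPerm n (f ∘ swapAtᵛ p) ≡ sumPerm n f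
sumPerm-swapAt n p f = begin
  sumPerm n (f ∘ swapAtᵛ p)
    ≡⟨ sumPerm≡∑allVec (f ∘ swapAtᵛ p) ⟩
  ∑[ v ∈ allVec n n ] (if does (isPerm? v) then f (swapAtᵛ p v) else 0)
    ≡⟨ ∑-cong (allVec n n) (λ v → if-cong (sym (isPerm?-swapAt p v))) ⟩
  ∑[ v ∈ allVec n n ] (if does (isPerm? (swapAtᵛ p v)) then f (swapAtᵛ p v) else 0)
    ≡⟨ ∑-allVec-swapAt n p (λ w → if does (isPerm? w) then f w else 0) ⟩
  ∑[ v ∈ allVec n n ] (if does (isPerm? v) then f v else 0)
    ≡⟨ sumPerm≡∑allVec f ⟨
  sumPerm n f ∎

sumPerm-cong : ∀ n {f g : Vec (Fin n) n → ℕ} → (∀ π → IsPerm π → f π ≡ g π) → sumPerm n f ≡ sumPerm n g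
sumPerm-cong n {f} {g} f≗g = begin
  sumPerm n f                                                 ≡⟨ sumPerm≡∑allVec f ⟩
  ∑[ v ∈ allVec n n ] (if does (isPerm? v) then f v else 0)   ≡⟨ ∑-cong (allVec n n) on-perms ⟩
  ∑[ v ∈ allVec n n ] (if does (isPerm? v) then g v else 0)   ≡⟨ sumPerm≡∑allVec g ⟨
  sumPerm n g                                                 ∎
  where
  on-perms : ∀ v → (if does (isPerm? v) then f v else 0) ≡ (if does (isPerm? v) then g v else 0)
  on-perms v with isPerm? v
  ... | yes π = f≗g v π
  ... | no _  = refl

sumPerm-+ : ∀ n (f g : Vec (Fin n) n → ℕ) → sumPerm n (λ π → f π + g π) ≡ sumPerm n f + sumPerm n g
sumPerm-+ n f g = ∑-+ (Sym n) f g

-- Labellings and the permutations fitting them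

data Label : Set where
  N I J B : Label

above : Maybe ℕ → ℕ → Bool
above nothing  x = true
above (just b) x = b <ᵇ x

-- bI and bJ are the last entries taken so far into the first and the second subsequence.
fits : Maybe ℕ → Maybe ℕ → List Label → List ℕ → ℕ
fits bI bJ []       xs       = 1
fits bI bJ (_ ∷ ls) []       = 0
fits bI bJ (N ∷ ls) (x ∷ xs) = fits bI bJ ls xs
fits bI bJ (I ∷ ls) (x ∷ xs) = if above bI x then fits (just x) bJ ls xs else 0
fits bI bJ (J ∷ ls) (x ∷ xs) = if above bJ x then fits bI (just x) ls xs else 0
fits bI bJ (B ∷ ls) (x ∷ xs) = if above bI x ∧ above bJ x then fits (just x) (just x) ls xs else 0

fitCount : ℕ → List Label → ℕ
fitCount n ls = sumPerm n (λ π → fits nothing nothing ls (values π))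

data Commute : Label → Label → Set where
  N∙ : ∀ {a} → Commute N a
  ∙N : ∀ {a} → Commute a N
  IJ : Commute I J
  JI : Commute J I

fits-swap₀ : ∀ bI bJ {a b} ρ xs → Commute a b → fits bI bJ (a ∷ b ∷ ρ) xs ≡ fits bI bJ (b ∷ a ∷ ρ) (swapAt 0 xs)
fits-swap₀ bI bJ ρ []           _  = refl
fits-swap₀ bI bJ {b = N} ρ (x ∷ []) N∙ = refl
fits-swap₀ bI bJ {b = I} ρ (x ∷ []) N∙ = sym (if-eta (above bI x))
fits-swap₀ bI bJ {b = J} ρ (x ∷ []) N∙ = sym (if-eta (above bJ x))
fits-swap₀ bI bJ {b = B} ρ (x ∷ []) N∙ = sym (if-eta (above bI x ∧ above bJ x))
fits-swap₀ bI bJ {a = N} ρ (x ∷ []) ∙N = refl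
fits-swap₀ bI bJ {a = I} ρ (x ∷ []) ∙N = if-eta (above bI x)
fits-swap₀ bI bJ {a = J} ρ (x ∷ []) ∙N = if-eta (above bJ x)
fits-swap₀ bI bJ {a = B} ρ (x ∷ []) ∙N = if-eta (above bI x ∧ above bJ x)
fits-swap₀ bI bJ ρ (x ∷ [])     IJ = trans (if-eta (above bI x)) (sym (if-eta (above bJ x)))
fits-swap₀ bI bJ ρ (x ∷ [])     JI = trans (if-eta (above bJ x)) (sym (if-eta (above bI x)))
fits-swap₀ bI bJ {b = N} ρ (x ∷ y ∷ xs) N∙ = refl
fits-swap₀ bI bJ {b = I} ρ (x ∷ y ∷ xs) N∙ = refl
fits-swap₀ bI bJ {b = J} ρ (x ∷ y ∷ xs) N∙ = refl
fits-swap₀ bI bJ {b = B} ρ (x ∷ y ∷ xs) N∙ = refl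
fits-swap₀ bI bJ {a = N} ρ (x ∷ y ∷ xs) ∙N = refl
fits-swap₀ bI bJ {a = I} ρ (x ∷ y ∷ xs) ∙N = refl
fits-swap₀ bI bJ {a = J} ρ (x ∷ y ∷ xs) ∙N = refl
fits-swap₀ bI bJ {a = B} ρ (x ∷ y ∷ xs) ∙N = refl
fits-swap₀ bI bJ ρ (x ∷ y ∷ xs) IJ = if-swap-then (above bI x) (above bJ y)
fits-swap₀ bI bJ ρ (x ∷ y ∷ xs) JI = if-swap-then (above bJ x) (above bI y)

fits-swapAt : ∀ bI bJ ν {a b} ρ xs → Commute a b →
  fits bI bJ (ν ++ a ∷ b ∷ ρ) xs ≡ fits bI bJ (ν ++ b ∷ a ∷ ρ) (swapAt (length ν) xs)
fits-swapAt bI bJ []      ρ xs       ab = fits-swap₀ bI bJ ρ xs ab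
fits-swapAt bI bJ (_ ∷ ν) ρ []       ab = refl
fits-swapAt bI bJ (N ∷ ν) ρ (x ∷ xs) ab = fits-swapAt bI bJ ν ρ xs ab
fits-swapAt bI bJ (I ∷ ν) ρ (x ∷ xs) ab = if-cong-then (above bI x) (fits-swapAt (just x) bJ ν ρ xs ab)
fits-swapAt bI bJ (J ∷ ν) ρ (x ∷ xs) ab = if-cong-then (above bJ x) (fits-swapAt bI (just x) ν ρ xs ab)
fits-swapAt bI bJ (B ∷ ν) ρ (x ∷ xs) ab =
  if-cong-then (above bI x ∧ above bJ x) (fits-swapAt (just x) (just x) ν ρ xs ab)

fitCount-swap : ∀ n ν {a b} ρ → Commute a b → fitCount n (ν ++ a ∷ b ∷ ρ) ≡ fitCount n (ν ++ b ∷ a ∷ ρ)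
fitCount-swap n ν {a} {b} ρ ab = begin
  fitCount n (ν ++ a ∷ b ∷ ρ)
    ≡⟨ sumPerm-cong n (λ π _ → trans (fits-swapAt nothing nothing ν ρ (values π) ab)
                                   (cong (fits nothing nothing (ν ++ b ∷ a ∷ ρ)) (sym (values-swapAt (length ν) π)))) ⟩
  sumPerm n (λ π → fits nothing nothing (ν ++ b ∷ a ∷ ρ) (values (swapAtᵛ (length ν) π)))
    ≡⟨ sumPerm-swapAt n (length ν) (λ π → fits nothing nothing (ν ++ b ∷ a ∷ ρ) (values π)) ⟩
  fitCount n (ν ++ b ∷ a ∷ ρ) ∎

fitCount-bubble : ∀ n ν {a} w ρ → All (Commute a) w → fitCount n (ν ++ a ∷ w ++ ρ) ≡ fitCount n (ν ++ w ++ a ∷ ρ)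
fitCount-bubble n ν {a} []      ρ []         = refl
fitCount-bubble n ν {a} (b ∷ w) ρ (ab ∷ aw) = begin
  fitCount n (ν ++ a ∷ b ∷ w ++ ρ)        ≡⟨ fitCount-swap n ν (w ++ ρ) ab ⟩
  fitCount n (ν ++ b ∷ a ∷ w ++ ρ)        ≡⟨ cong (fitCount n) (++-assoc ν [ b ] (a ∷ w ++ ρ)) ⟨
  fitCount n ((ν ++ [ b ]) ++ a ∷ w ++ ρ) ≡⟨ fitCount-bubble n (ν ++ [ b ]) w ρ aw ⟩
  fitCount n ((ν ++ [ b ]) ++ w ++ a ∷ ρ) ≡⟨ cong (fitCount n) (++-assoc ν [ b ] (w ++ a ∷ ρ)) ⟩
  fitCount n (ν ++ b ∷ w ++ a ∷ ρ)        ∎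

flip : Label → Label
flip N = N
flip I = J
flip J = I
flip B = B

fits-flip : ∀ bI bJ ls xs → fits bI bJ (map flip ls) xs ≡ fits bJ bI ls xs
fits-flip bI bJ []       xs       = refl
fits-flip bI bJ (_ ∷ ls) []       = refl
fits-flip bI bJ (N ∷ ls) (x ∷ xs) = fits-flip bI bJ ls xs
fits-flip bI bJ (I ∷ ls) (x ∷ xs) = if-cong-then (above bJ x) (fits-flip bI (just x) ls xs)
fits-flip bI bJ (J ∷ ls) (x ∷ xs) = if-cong-then (above bI x) (fits-flip (just x) bJ ls xs)
fits-flip bI bJ (B ∷ ls) (x ∷ xs) =
  trans (if-cong-then (above bI x ∧ above bJ x) (fits-flip (just x) (just x) ls xs)) (if-cong (∧-comm (above bI x) (above bJ x)))

fitCount-flip : ∀ n ls → fitCount n (map flip ls) ≡ fitCount n ls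
fitCount-flip n ls = sumPerm-cong n (λ π _ → fits-flip nothing nothing ls (values π))

<ᵇ≡true⇒< : ∀ {a b} → (a <ᵇ b) ≡ true → a < b
<ᵇ≡true⇒< {a} {b} a<ᵇb = <ᵇ⇒< a b (subst T (sym a<ᵇb) tt)

<⇒<ᵇ≡true : ∀ {a b} → a < b → (a <ᵇ b) ≡ true
<⇒<ᵇ≡true {a} {b} a<b with a <ᵇ b | <⇒<ᵇ a<b
... | true | _ = refl

≤⇒<ᵇ≡false : ∀ {a b} → b ≤ a → (a <ᵇ b) ≡ false
≤⇒<ᵇ≡false {a} {b} b≤a with a <ᵇ b in a<ᵇb
... | true  = ⊥-elim (<⇒≱ (<ᵇ≡true⇒< a<ᵇb) b≤a)
... | false = refl

above-< : ∀ b {x y} → above b x ≡ true → x < y → above b y ≡ true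
above-< nothing  _  _   = refl
above-< (just c) {y = y} cx x<y = <⇒<ᵇ≡true {c} {y} (<-trans (<ᵇ≡true⇒< cx) x<y)

_≤ᴹ_ : Maybe ℕ → Maybe ℕ → Set
nothing ≤ᴹ _      = ⊤
just a  ≤ᴹ nothing = ⊥
just a  ≤ᴹ just b  = a ≤ b

≤ᴹ-above : ∀ bJ bI {x} → bJ ≤ᴹ bI → above bI x ≡ true → above bJ x ≡ true
≤ᴹ-above nothing  bI       _   _  = refl
≤ᴹ-above (just a) (just c) {x} a≤c cx = <⇒<ᵇ≡true {a} {x} (≤-<-trans a≤c (<ᵇ≡true⇒< cx))

≤ᴹ-just : ∀ bJ bI {x} → bJ ≤ᴹ bI → above bI x ≡ true → bJ ≤ᴹ just x
≤ᴹ-just nothing  bI       _   _  = tt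
≤ᴹ-just (just a) (just c) a≤c cx = <⇒≤ (≤-<-trans a≤c (<ᵇ≡true⇒< cx))

above⇒≤ᴹ : ∀ b {x} → above b x ≡ true → b ≤ᴹ just x
above⇒≤ᴹ nothing  _  = tt
above⇒≤ᴹ (just c) cx = <⇒≤ (<ᵇ≡true⇒< cx)

NoJBeforeB : List Label → Set
NoJBeforeB []      = ⊤
NoJBeforeB (N ∷ ρ) = NoJBeforeB ρ
NoJBeforeB (I ∷ ρ) = NoJBeforeB ρ
NoJBeforeB (J ∷ ρ) = ⊥
NoJBeforeB (B ∷ ρ) = ⊤

-- No J reads the second bound before the next B, and at that B the first bound implies it.
fits-NoJBeforeB : ∀ bI bJ ρ xs → bJ ≤ᴹ bI → NoJBeforeB ρ → fits bI bJ ρ xs ≡ fits bI bI ρ xs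
fits-NoJBeforeB bI bJ []      xs       _  _  = refl
fits-NoJBeforeB bI bJ (_ ∷ ρ) []       _  _  = refl
fits-NoJBeforeB bI bJ (N ∷ ρ) (x ∷ xs) le nj = fits-NoJBeforeB bI bJ ρ xs le nj
fits-NoJBeforeB bI bJ (I ∷ ρ) (x ∷ xs) le nj with above bI x in bx
... | true  = trans (fits-NoJBeforeB (just x) bJ ρ xs (≤ᴹ-just bJ bI le bx) nj)
                    (sym (fits-NoJBeforeB (just x) bI ρ xs (above⇒≤ᴹ bI bx) nj))
... | false = refl
fits-NoJBeforeB bI bJ (B ∷ ρ) (x ∷ xs) le nj with above bI x in bx
... | true rewrite ≤ᴹ-above bJ bI le bx = refl
... | false = refl

data Shared : Label → Set where
  sN : Shared N
  sB : Shared B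

fits-Shared-prefix : ∀ ν {l₁ l₂} → All Shared ν → (∀ b xs → fits b b l₁ xs ≡ fits b b l₂ xs) →
  ∀ b xs → fits b b (ν ++ l₁) xs ≡ fits b b (ν ++ l₂) xs
fits-Shared-prefix []      _          eq b xs       = eq b xs
fits-Shared-prefix (_ ∷ ν) _          eq b []       = refl
fits-Shared-prefix (N ∷ ν) (sN ∷ shν) eq b (x ∷ xs) = fits-Shared-prefix ν shν eq b xs
fits-Shared-prefix (B ∷ ν) (sB ∷ shν) eq b (x ∷ xs) =
  if-cong-then (above b x ∧ above b x) (fits-Shared-prefix ν shν eq (just x) xs)

fits-I≡B : ∀ ρ → NoJBeforeB ρ → ∀ b xs → fits b b (I ∷ ρ) xs ≡ fits b b (B ∷ ρ) xs
fits-I≡B ρ nj b []       = refl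
fits-I≡B ρ nj b (x ∷ xs) with above b x in bx
... | true  = fits-NoJBeforeB (just x) b ρ xs (above⇒≤ᴹ b bx) nj
... | false = refl

fitCount-I≡B : ∀ n ν ρ → All Shared ν → NoJBeforeB ρ → fitCount n (ν ++ I ∷ ρ) ≡ fitCount n (ν ++ B ∷ ρ)
fitCount-I≡B n ν ρ shν nj =
  sumPerm-cong n (λ π _ → fits-Shared-prefix ν shν (fits-I≡B ρ nj) nothing (values π))

values-unique : ∀ {n} {π : Vec (Fin n) n} → IsPerm π → AllPairs _≢_ (values π)
values-unique {π = π} uniq = subst (AllPairs _≢_) (sym (toList-map toℕ π))
  (AllPairs.map⁺ (AllPairs.map (λ x≢y → x≢y ∘ toℕ-injective) uniq))

-- Two distinct adjacent entries x, y are increasing in exactly one of the orders x y and y x.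
fits-IJ-split₀ : ∀ b ρ xs → AllPairs _≢_ xs →
  fits b b (I ∷ J ∷ ρ) xs ≡ fits b b (B ∷ J ∷ ρ) xs + fits b b (B ∷ I ∷ ρ) (swapAt 0 xs)
fits-IJ-split₀ b ρ []           _ = refl
fits-IJ-split₀ b ρ (x ∷ [])     _ with above b x
... | true  = refl
... | false = refl
fits-IJ-split₀ b ρ (x ∷ y ∷ xs) ((x≢y ∷ _) ∷ _) with <-cmp x y
... | tri≈ _ x≡y _ = ⊥-elim (x≢y x≡y)
... | tri< x<y _ _ rewrite ≤⇒<ᵇ≡false (<⇒≤ x<y) | if-eta (above b y ∧ above b y) {0} | <⇒<ᵇ≡true x<y
                         | +-identityʳ (if above b x ∧ above b x then fits (just x) (just y) ρ xs else 0)
                         with above b x in bx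
...   | true rewrite above-< b bx x<y = refl
...   | false = refl
fits-IJ-split₀ b ρ (x ∷ y ∷ xs) ((x≢y ∷ _) ∷ _) | tri> _ _ y<x
  rewrite ≤⇒<ᵇ≡false (<⇒≤ y<x) | if-eta (above b x ∧ above b x) {0} | <⇒<ᵇ≡true y<x with above b y in by
...   | true rewrite above-< b by y<x = refl
...   | false = if-eta (above b x)

fits-IJ-split : ∀ ν ρ → All Shared ν → ∀ b xs → AllPairs _≢_ xs →
  fits b b (ν ++ I ∷ J ∷ ρ) xs ≡ fits b b (ν ++ B ∷ J ∷ ρ) xs + fits b b (ν ++ B ∷ I ∷ ρ) (swapAt (length ν) xs)
fits-IJ-split []      ρ _          b xs       distinct      = fits-IJ-split₀ b ρ xs distinct
fits-IJ-split (_ ∷ ν) ρ _          b []       _             = refl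
fits-IJ-split (N ∷ ν) ρ (sN ∷ shν) b (x ∷ xs) (_ ∷ distinct) = fits-IJ-split ν ρ shν b xs distinct
fits-IJ-split (B ∷ ν) ρ (sB ∷ shν) b (x ∷ xs) (_ ∷ distinct) with above b x ∧ above b x
... | true  = fits-IJ-split ν ρ shν (just x) xs distinct
... | false = refl

fitCount-IJ-split : ∀ n ν ρ → All Shared ν →
  fitCount n (ν ++ I ∷ J ∷ ρ) ≡ fitCount n (ν ++ B ∷ J ∷ ρ) + fitCount n (ν ++ B ∷ I ∷ ρ)
fitCount-IJ-split n ν ρ shν = begin
  fitCount n (ν ++ I ∷ J ∷ ρ)
    ≡⟨ sumPerm-cong n (λ π isPerm → trans (fits-IJ-split ν ρ shν nothing (values π) (values-unique isPerm))
                                          (cong (λ xs → fitsBJ π + fits nothing nothing (ν ++ B ∷ I ∷ ρ) xs)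
                                                (sym (values-swapAt (length ν) π)))) ⟩
  sumPerm n (λ π → fitsBJ π + fitsBI (swapAtᵛ (length ν) π))
    ≡⟨ sumPerm-+ n fitsBJ (fitsBI ∘ swapAtᵛ (length ν)) ⟩
  fitCount n (ν ++ B ∷ J ∷ ρ) + sumPerm n (fitsBI ∘ swapAtᵛ (length ν))
    ≡⟨ cong (fitCount n (ν ++ B ∷ J ∷ ρ) +_) (sumPerm-swapAt n (length ν) fitsBI) ⟩
  fitCount n (ν ++ B ∷ J ∷ ρ) + fitCount n (ν ++ B ∷ I ∷ ρ) ∎
  where
  fitsBJ fitsBI : Vec (Fin n) n → ℕ
  fitsBJ π = fits nothing nothing (ν ++ B ∷ J ∷ ρ) (values π)
  fitsBI π = fits nothing nothing (ν ++ B ∷ I ∷ ρ) (values π)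

-- Shuffle weights

shuffles : ℕ → ℕ → ℕ
shuffles zero    b       = 1
shuffles (suc a) zero    = 1
shuffles (suc a) (suc b) = shuffles a (suc b) + shuffles (suc a) b

shuffles-0 : ∀ a → shuffles a 0 ≡ 1
shuffles-0 zero    = refl
shuffles-0 (suc a) = refl

shuffles-1 : ∀ a → shuffles a 1 ≡ suc a
shuffles-1 zero    = refl
shuffles-1 (suc a) = trans (cong (_+ 1) (shuffles-1 a)) (+-comm (suc a) 1)

shuffles-comm : ∀ a b → shuffles a b ≡ shuffles b a
shuffles-comm zero    zero    = refl
shuffles-comm zero    (suc b) = refl
shuffles-comm (suc a) zero    = refl
shuffles-comm (suc a) (suc b) =
  trans (cong₂ _+_ (shuffles-comm a (suc b)) (shuffles-comm (suc a) b)) (+-comm (shuffles (suc b) a) (shuffles b (suc a)))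

shuffles≡multinom2 : ∀ a b → shuffles a b ≡ multinom2 a b
shuffles≡multinom2 zero    b       = refl
shuffles≡multinom2 (suc a) zero    = sym (trans (cong (_C suc a) (+-identityʳ (suc a))) (nCn≡1 (suc a)))
shuffles≡multinom2 (suc a) (suc b) = begin
  shuffles a (suc b) + shuffles (suc a) b    ≡⟨ cong₂ _+_ (shuffles≡multinom2 a (suc b)) (shuffles≡multinom2 (suc a) b) ⟩
  (a + suc b) C a + (suc a + b) C suc a      ≡⟨ cong (λ m → (a + suc b) C a + m C suc a) (sym (+-suc a b)) ⟩
  (a + suc b) C a + (a + suc b) C suc a      ≡⟨ nCk+nC[k+1]≡[n+1]C[k+1] (a + suc b) a ⟩
  suc (a + suc b) C suc a                    ∎

-- The product over the B-separated blocks of ls of shuffles(#I, #J), where the first block is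
-- credited with α extra I's and β extra J's.
weight : ℕ → ℕ → List Label → ℕ
weight α β []      = shuffles α β
weight α β (N ∷ l) = weight α β l
weight α β (I ∷ l) = weight (suc α) β l
weight α β (J ∷ l) = weight α (suc β) l
weight α β (B ∷ l) = shuffles α β * weight 0 0 l

weight-pascal : ∀ a b ρ → weight (suc a) (suc b) ρ ≡ weight a (suc b) ρ + weight (suc a) b ρ
weight-pascal a b []      = refl
weight-pascal a b (N ∷ ρ) = weight-pascal a b ρ
weight-pascal a b (I ∷ ρ) = weight-pascal (suc a) b ρ
weight-pascal a b (J ∷ ρ) = weight-pascal a (suc b) ρ
weight-pascal a b (B ∷ ρ) = *-distribʳ-+ (weight 0 0 ρ) (shuffles a (suc b)) (shuffles (suc a) b)

weight-NoJBeforeB : ∀ α ρ → NoJBeforeB ρ → weight α 0 ρ ≡ weight 0 0 ρ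
weight-NoJBeforeB α []      _  = shuffles-0 α
weight-NoJBeforeB α (N ∷ ρ) nj = weight-NoJBeforeB α ρ nj
weight-NoJBeforeB α (I ∷ ρ) nj = trans (weight-NoJBeforeB (suc α) ρ nj) (sym (weight-NoJBeforeB 1 ρ nj))
weight-NoJBeforeB α (B ∷ ρ) _  = cong (_* weight 0 0 ρ) (shuffles-0 α)

weight-flip : ∀ α β l → weight α β (map flip l) ≡ weight β α l
weight-flip α β []      = shuffles-comm α β
weight-flip α β (N ∷ l) = weight-flip α β l
weight-flip α β (I ∷ l) = weight-flip α (suc β) l
weight-flip α β (J ∷ l) = weight-flip (suc α) β l
weight-flip α β (B ∷ l) = cong₂ _*_ (shuffles-comm α β) (weight-flip 0 0 l)

isI isB isN inSome inOne : Label → ℕ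
isI I = 1
isI _ = 0
isB B = 1
isB _ = 0
isN N = 1
isN _ = 0
inSome N = 0
inSome _ = 1
inOne I = 1
inOne J = 1
inOne _ = 0

∑-flip : ∀ (p : Label → ℕ) → (∀ a → p (flip a) ≡ p a) → ∀ l → ∑ (map flip l) p ≡ ∑ l p
∑-flip p p∘flip≗p l = trans (∑-map flip l p) (∑-cong l p∘flip≗p)

∑-middle : ∀ (p : Label → ℕ) w c ρ → ∑ (w ++ c ∷ ρ) p ≡ p c + ∑ (w ++ ρ) p
∑-middle p []      c ρ = refl
∑-middle p (a ∷ w) c ρ = begin
  p a + ∑ (w ++ c ∷ ρ) p     ≡⟨ cong (p a +_) (∑-middle p w c ρ) ⟩
  p a + (p c + ∑ (w ++ ρ) p) ≡⟨ x∙yz≈y∙xz (p a) (p c) _ ⟩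
  p c + (p a + ∑ (w ++ ρ) p) ∎

∑-replicate : ∀ (p : Label → ℕ) m x → ∑ (replicate m x) p ≡ m * p x
∑-replicate p zero    x = refl
∑-replicate p (suc m) x = cong (p x +_) (∑-replicate p m x)

data IorN : Label → Set where
  iI : IorN I
  iN : IorN N

weight-IorN-prefix : ∀ α β w ρ → All IorN w → weight α β (w ++ ρ) ≡ weight (∑ w isI + α) β ρ
weight-IorN-prefix α β []      ρ []         = refl
weight-IorN-prefix α β (I ∷ w) ρ (iI ∷ inw) =
  trans (weight-IorN-prefix (suc α) β w ρ inw) (cong (λ a → weight a β ρ) (+-suc (∑ w isI) α))
weight-IorN-prefix α β (N ∷ w) ρ (iN ∷ inw) = weight-IorN-prefix α β w ρ inw

Commute-J-IorN : ∀ {w} → All IorN w → All (Commute J) w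
Commute-J-IorN []          = []
Commute-J-IorN (iI ∷ inw)  = JI ∷ Commute-J-IorN inw
Commute-J-IorN (iN ∷ inw)  = ∙N ∷ Commute-J-IorN inw

flip-Shared : ∀ {ν} → All Shared ν → map flip ν ≡ ν
flip-Shared []          = refl
flip-Shared (sN ∷ shν)  = cong (N ∷_) (flip-Shared shν)
flip-Shared (sB ∷ shν)  = cong (B ∷_) (flip-Shared shν)

NoJBeforeB-or-J : (ρ : List Label) →
  NoJBeforeB ρ ⊎ Σ (List Label) (λ w → Σ (List Label) (λ ρ′ → (ρ ≡ w ++ J ∷ ρ′) × All IorN w))
NoJBeforeB-or-J []      = inj₁ tt
NoJBeforeB-or-J (N ∷ ρ) with NoJBeforeB-or-J ρ
... | inj₁ nj                  = inj₁ nj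
... | inj₂ (w , ρ′ , refl , inw) = inj₂ (N ∷ w , ρ′ , refl , iN ∷ inw)
NoJBeforeB-or-J (I ∷ ρ) with NoJBeforeB-or-J ρ
... | inj₁ nj                  = inj₁ nj
... | inj₂ (w , ρ′ , refl , inw) = inj₂ (I ∷ w , ρ′ , refl , iI ∷ inw)
NoJBeforeB-or-J (J ∷ ρ) = inj₂ ([] , ρ , refl , [])
NoJBeforeB-or-J (B ∷ ρ) = inj₁ tt

incPrefixCount : ℕ → ℕ → ℕ
incPrefixCount n u = fitCount n (replicate u B ++ replicate (n ∸ u) N)

fitCount-sort-Shared : ∀ n ν μ → All Shared μ →
  fitCount n (ν ++ μ) ≡ fitCount n (ν ++ replicate (∑ μ isB) B ++ replicate (∑ μ isN) N)
fitCount-sort-Shared n ν []      []         = refl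
fitCount-sort-Shared n ν (B ∷ μ) (sB ∷ shμ) = begin
  fitCount n (ν ++ B ∷ μ)              ≡⟨ cong (fitCount n) (++-assoc ν [ B ] μ) ⟨
  fitCount n ((ν ++ [ B ]) ++ μ)       ≡⟨ fitCount-sort-Shared n (ν ++ [ B ]) μ shμ ⟩
  fitCount n ((ν ++ [ B ]) ++ sorted)  ≡⟨ cong (fitCount n) (++-assoc ν [ B ] sorted) ⟩
  fitCount n (ν ++ B ∷ sorted)         ∎
  where
  sorted : List Label
  sorted = replicate (∑ μ isB) B ++ replicate (∑ μ isN) N
fitCount-sort-Shared n ν (N ∷ μ) (sN ∷ shμ) = begin
  fitCount n (ν ++ N ∷ μ)                 ≡⟨ cong (fitCount n) (++-assoc ν [ N ] μ) ⟨
  fitCount n ((ν ++ [ N ]) ++ μ)          ≡⟨ fitCount-sort-Shared n (ν ++ [ N ]) μ shμ ⟩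
  fitCount n ((ν ++ [ N ]) ++ Bs ++ Ns)   ≡⟨ cong (fitCount n) (++-assoc ν [ N ] (Bs ++ Ns)) ⟩
  fitCount n (ν ++ N ∷ Bs ++ Ns)          ≡⟨ fitCount-bubble n ν Bs Ns (N-commutes (∑ μ isB)) ⟩
  fitCount n (ν ++ Bs ++ N ∷ Ns)          ∎
  where
  Bs Ns : List Label
  Bs = replicate (∑ μ isB) B
  Ns = replicate (∑ μ isN) N
  N-commutes : ∀ k → All (Commute N) (replicate k B)
  N-commutes zero    = []
  N-commutes (suc k) = N∙ ∷ N-commutes k

length-Shared : ∀ {ν} → All Shared ν → length ν ≡ ∑ ν isB + ∑ ν isN
length-Shared []          = refl
length-Shared (sN ∷ shν)  = trans (cong suc (length-Shared shν)) (sym (+-suc _ _))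
length-Shared (sB ∷ shν)  = cong suc (length-Shared shν)

fitCount-Shared : ∀ n ν → All Shared ν → length ν ≡ n → fitCount n ν ≡ incPrefixCount n (∑ ν isB)
fitCount-Shared n ν shν refl = trans (fitCount-sort-Shared n [] ν shν) (cong (λ m → fitCount n (replicate b B ++ replicate m N)) #N)
  where
  b : ℕ
  b = ∑ ν isB
  #N : ∑ ν isN ≡ length ν ∸ b
  #N = sym (trans (cong (_∸ b) (length-Shared shν)) (m+n∸m≡n b (∑ ν isN)))

weight-pascal-IorN : ∀ w ρ → All IorN w → weight 0 1 (w ++ ρ) + weight 1 0 (w ++ ρ) ≡ weight 1 0 (w ++ J ∷ ρ)
weight-pascal-IorN w ρ inw = begin
  weight 0 1 (w ++ ρ) + weight 1 0 (w ++ ρ)   ≡⟨ cong₂ _+_ (weight-IorN-prefix 0 1 w ρ inw) (weight-IorN-prefix 1 0 w ρ inw) ⟩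
  weight (i + 0) 1 ρ + weight (i + 1) 0 ρ     ≡⟨ cong₂ (λ a b → weight a 1 ρ + weight b 0 ρ) (+-identityʳ i) (+-comm i 1) ⟩
  weight i 1 ρ + weight (suc i) 0 ρ           ≡⟨ weight-pascal i 0 ρ ⟨
  weight (suc i) 1 ρ                          ≡⟨ cong (λ a → weight a 1 ρ) (+-comm 1 i) ⟩
  weight (i + 1) 1 ρ                          ≡⟨ weight-IorN-prefix 1 0 w (J ∷ ρ) inw ⟨
  weight 1 0 (w ++ J ∷ ρ)                     ∎
  where
  i : ℕ
  i = ∑ w isI

∑-snoc-Shared : ∀ ν {c} → Shared c → ∀ s → ∑ (ν ++ [ c ]) isB + s ≡ ∑ ν isB + (inSome c + s)
∑-snoc-Shared ν {c} sc s = begin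
  ∑ (ν ++ [ c ]) isB + s         ≡⟨ cong (_+ s) (∑-++ ν [ c ] isB) ⟩
  ∑ ν isB + (isB c + 0) + s      ≡⟨ +-assoc (∑ ν isB) (isB c + 0) s ⟩
  ∑ ν isB + (isB c + 0 + s)      ≡⟨ cong (∑ ν isB +_) (isB≡inSome sc) ⟩
  ∑ ν isB + (inSome c + s)       ∎
  where
  isB≡inSome : ∀ {c} → Shared c → isB c + 0 + s ≡ inSome c + s
  isB≡inSome sN = refl
  isB≡inSome sB = refl

-- Induction on the number of I/J labels after the N/B prefix ν; a leading J becomes an I by flip.
-- After a leading I, the first J before the next B commutes leftwards past I's and N's until
-- it is adjacent, and then I J splits into B J + B I; if there is no such J, the I may become a B.
mutual
  fitCount-weight : ∀ f n ν l → ∑ l inOne ≤ f → All Shared ν → length ν + length l ≡ n →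
    fitCount n (ν ++ l) ≡ weight 0 0 l * incPrefixCount n (∑ ν isB + ∑ l inSome)
  fitCount-weight f n ν [] _ shν len = begin
    fitCount n (ν ++ [])                ≡⟨ cong (fitCount n) (++-identityʳ ν) ⟩
    fitCount n ν                        ≡⟨ fitCount-Shared n ν shν (trans (sym (+-identityʳ _)) len) ⟩
    incPrefixCount n (∑ ν isB)          ≡⟨ cong (incPrefixCount n) (+-identityʳ (∑ ν isB)) ⟨
    incPrefixCount n (∑ ν isB + 0)      ≡⟨ +-identityʳ _ ⟨
    1 * incPrefixCount n (∑ ν isB + 0)  ∎
  fitCount-weight f n ν (N ∷ l) bound shν len = fitCount-weight-Shared f n ν l sN bound shν len
  fitCount-weight f n ν (B ∷ l) bound shν len =
    trans (fitCount-weight-Shared f n ν l sB bound shν len) (cong (_* incPrefixCount n (∑ ν isB + suc (∑ l inSome))) (sym (*-identityˡ (weight 0 0 l))))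
  fitCount-weight f n ν (I ∷ l) bound shν len = fitCount-weightᴵ f n ν l bound shν len
  fitCount-weight f n ν (J ∷ l) bound shν len = begin
    fitCount n (ν ++ J ∷ l)               ≡⟨ fitCount-flip n (ν ++ J ∷ l) ⟨
    fitCount n (map flip (ν ++ J ∷ l))    ≡⟨ cong (fitCount n) (trans (map-++ flip ν (J ∷ l)) (cong (_++ I ∷ map flip l) (flip-Shared shν))) ⟩
    fitCount n (ν ++ I ∷ map flip l)      ≡⟨ fitCount-weightᴵ f n ν (map flip l) (subst (λ m → suc m ≤ f) (sym (∑-flip inOne inOne∘flip l)) bound) shν
                                                            (trans (cong (λ m → length ν + suc m) (length-map flip l)) len) ⟩
    weight 1 0 (map flip l) * incPrefixCount n (∑ ν isB + suc (∑ (map flip l) inSome))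
      ≡⟨ cong₂ (λ w m → w * incPrefixCount n (∑ ν isB + suc m)) (weight-flip 1 0 l) (∑-flip inSome inSome∘flip l) ⟩
    weight 0 1 l * incPrefixCount n (∑ ν isB + suc (∑ l inSome)) ∎
    where
    inOne∘flip : ∀ a → inOne (flip a) ≡ inOne a
    inOne∘flip N = refl
    inOne∘flip I = refl
    inOne∘flip J = refl
    inOne∘flip B = refl
    inSome∘flip : ∀ a → inSome (flip a) ≡ inSome a
    inSome∘flip N = refl
    inSome∘flip I = refl
    inSome∘flip J = refl
    inSome∘flip B = refl

  fitCount-weight-Shared : ∀ f n ν {c} l → Shared c → ∑ l inOne ≤ f → All Shared ν → length ν + suc (length l) ≡ n →
    fitCount n (ν ++ c ∷ l) ≡ weight 0 0 l * incPrefixCount n (∑ ν isB + ∑ (c ∷ l) inSome)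
  fitCount-weight-Shared f n ν {c} l sc bound shν len = begin
    fitCount n (ν ++ c ∷ l)
      ≡⟨ cong (fitCount n) (++-assoc ν [ c ] l) ⟨
    fitCount n ((ν ++ [ c ]) ++ l)
      ≡⟨ fitCount-weight f n (ν ++ [ c ]) l bound (++⁺ shν (sc ∷ [])) (trans length-snoc len) ⟩
    weight 0 0 l * incPrefixCount n (∑ (ν ++ [ c ]) isB + ∑ l inSome)
      ≡⟨ cong (λ m → weight 0 0 l * incPrefixCount n m) (∑-snoc-Shared ν sc (∑ l inSome)) ⟩
    weight 0 0 l * incPrefixCount n (∑ ν isB + ∑ (c ∷ l) inSome) ∎
    where
    length-snoc : length (ν ++ [ c ]) + length l ≡ length ν + suc (length l)
    length-snoc = trans (cong (_+ length l) (length-++ ν)) (+-assoc (length ν) 1 (length l))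

  fitCount-weightᴵ : ∀ f n ν l → suc (∑ l inOne) ≤ f → All Shared ν → length ν + suc (length l) ≡ n →
    fitCount n (ν ++ I ∷ l) ≡ weight 1 0 l * incPrefixCount n (∑ ν isB + suc (∑ l inSome))
  fitCount-weightᴵ (suc f) n ν l (s≤s bound) shν len with NoJBeforeB-or-J l
  ... | inj₁ nj = begin
    fitCount n (ν ++ I ∷ l)  ≡⟨ fitCount-I≡B n ν l shν nj ⟩
    fitCount n (ν ++ B ∷ l)  ≡⟨ fitCount-weight-Shared f n ν l sB bound shν len ⟩
    weight 0 0 l * incPrefixCount n (∑ ν isB + suc (∑ l inSome))
      ≡⟨ cong (_* incPrefixCount n (∑ ν isB + suc (∑ l inSome))) (weight-NoJBeforeB 1 l nj) ⟨
    weight 1 0 l * incPrefixCount n (∑ ν isB + suc (∑ l inSome)) ∎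
  ... | inj₂ (w , ρ , refl , inw) = begin
    fitCount n (ν ++ I ∷ w ++ J ∷ ρ)
      ≡⟨ cong (fitCount n) (++-assoc ν [ I ] (w ++ J ∷ ρ)) ⟨
    fitCount n ((ν ++ [ I ]) ++ w ++ J ∷ ρ)
      ≡⟨ fitCount-bubble n (ν ++ [ I ]) w ρ (Commute-J-IorN inw) ⟨
    fitCount n ((ν ++ [ I ]) ++ J ∷ w ++ ρ)
      ≡⟨ cong (fitCount n) (++-assoc ν [ I ] (J ∷ w ++ ρ)) ⟩
    fitCount n (ν ++ I ∷ J ∷ w ++ ρ)
      ≡⟨ fitCount-IJ-split n ν (w ++ ρ) shν ⟩
    fitCount n (ν ++ B ∷ J ∷ w ++ ρ) + fitCount n (ν ++ B ∷ I ∷ w ++ ρ)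
      ≡⟨ cong₂ _+_ (fitCount-weight-Shared f n ν (J ∷ w ++ ρ) sB bound′ shν len′)
                   (fitCount-weight-Shared f n ν (I ∷ w ++ ρ) sB bound′ shν len′) ⟩
    weight 0 1 (w ++ ρ) * incPrefixCount n U + weight 1 0 (w ++ ρ) * incPrefixCount n U
      ≡⟨ *-distribʳ-+ (incPrefixCount n U) (weight 0 1 (w ++ ρ)) (weight 1 0 (w ++ ρ)) ⟨
    (weight 0 1 (w ++ ρ) + weight 1 0 (w ++ ρ)) * incPrefixCount n U
      ≡⟨ cong₂ _*_ (weight-pascal-IorN w ρ inw) (cong (λ m → incPrefixCount n (∑ ν isB + suc m)) (sym (∑-middle inSome w J ρ))) ⟩
    weight 1 0 (w ++ J ∷ ρ) * incPrefixCount n (∑ ν isB + suc (∑ (w ++ J ∷ ρ) inSome)) ∎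
    where
    U : ℕ
    U = ∑ ν isB + suc (suc (∑ (w ++ ρ) inSome))
    bound′ : suc (∑ (w ++ ρ) inOne) ≤ f
    bound′ = subst (_≤ f) (∑-middle inOne w J ρ) bound
    len′ : length ν + suc (suc (length (w ++ ρ))) ≡ n
    len′ = trans (cong (λ m → length ν + suc m) (sym (length-++-sucʳ w J ρ))) len

-- Expanding Z_k Z_ℓ over labellings

onPred : X → (ℕ → X) → ℕ → X
onPred d f zero    = d
onPred d f (suc k) = f k

onPred-cong : ∀ (d : X) {f g : ℕ → X} k → (∀ k′ → f k′ ≡ g k′) → onPred d f k ≡ onPred d g k
onPred-cong d zero    f≗g = refl
onPred-cong d (suc k) f≗g = f≗g k

∑-onPred : ∀ (F : ℕ → List X) k (g : X → ℕ) → ∑ (onPred [] F k) g ≡ onPred 0 (λ k′ → ∑ (F k′) g) k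
∑-onPred F zero    g = refl
∑-onPred F (suc k) g = refl

All-onPred : ∀ {P : X → Set} (F : ℕ → List X) k → (∀ k′ → All P (F k′)) → All P (onPred [] F k)
All-onPred F zero    all = []
All-onPred F (suc k) all = all k

labellings : ℕ → ℕ → ℕ → List (List Label)
labellings zero    zero zero = [ [] ]
labellings zero    _    _    = []
labellings (suc n) k    l    =
  map (N ∷_) (labellings n k l) ++
  onPred [] (λ k′ → map (I ∷_) (labellings n k′ l)) k ++
  onPred [] (λ l′ → map (J ∷_) (labellings n k l′)) l ++
  onPred [] (λ k′ → onPred [] (λ l′ → map (B ∷_) (labellings n k′ l′)) l) k

labellings-length : ∀ n k l → All (λ ls → length ls ≡ n) (labellings n k l)
labellings-length zero    zero    zero    = refl ∷ []
labellings-length zero    zero    (suc l) = []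
labellings-length zero    (suc k) l       = []
labellings-length (suc n) k       l       =
  ++⁺ (cons N (labellings-length n k l))
  (++⁺ (All-onPred _ k (λ k′ → cons I (labellings-length n k′ l)))
  (++⁺ (All-onPred _ l (λ l′ → cons J (labellings-length n k l′)))
       (All-onPred _ k (λ k′ → All-onPred _ l (λ l′ → cons B (labellings-length n k′ l′))))))
  where
  cons : ∀ c {L} → All (λ ls → length ls ≡ n) L → All (λ ls → length ls ≡ suc n) (map (c ∷_) L)
  cons c []             = []
  cons c (refl ∷ lens)  = refl ∷ cons c lens

incSubseq-∷ : ∀ b k x xs →
  incSubseq b k (x ∷ xs) ≡ onPred 0 (λ k′ → if above b x then incSubseq (just x) k′ xs else 0) k + incSubseq b k xs
incSubseq-∷ b        zero    x xs = refl
incSubseq-∷ nothing  (suc k) x xs = refl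
incSubseq-∷ (just v) (suc k) x xs = refl

onPred-expand : ∀ k l (p r : ℕ → ℕ) q s →
  (onPred 0 p k + q) * (onPred 0 r l + s)
    ≡ q * s + (onPred 0 (λ k′ → p k′ * s) k + (onPred 0 (λ l′ → q * r l′) l + onPred 0 (λ k′ → onPred 0 (λ l′ → p k′ * r l′) l) k))
onPred-expand zero    zero    p r q s = solve 2 (λ q s → q :* s := q :* s :+ (con 0 :+ (con 0 :+ con 0))) refl q s
onPred-expand zero    (suc l) p r q s = solve 3 (λ q r s → q :* (r :+ s) := q :* s :+ (con 0 :+ (q :* r :+ con 0))) refl q (r l) s
onPred-expand (suc k) zero    p r q s = solve 3 (λ p q s → (p :+ q) :* s := q :* s :+ (p :* s :+ (con 0 :+ con 0))) refl (p k) q s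
onPred-expand (suc k) (suc l) p r q s =
  solve 4 (λ p q r s → (p :+ q) :* (r :+ s) := q :* s :+ (p :* s :+ (q :* r :+ p :* r))) refl (p k) q (r l) s

*-if : ∀ q c {r} → q * (if c then r else 0) ≡ (if c then q * r else 0)
*-if q true  = refl
*-if q false = *-zeroʳ q

if-*-if : ∀ c d {p r} → (if c then p else 0) * (if d then r else 0) ≡ (if c ∧ d then p * r else 0)
if-*-if true  d {p} = *-if p d
if-*-if false d     = refl

∑-labellings-suc : ∀ n k l (g : List Label → ℕ) →
  ∑ (labellings (suc n) k l) g
    ≡ ∑[ ls ∈ labellings n k l ] g (N ∷ ls)
    + (onPred 0 (λ k′ → ∑[ ls ∈ labellings n k′ l ] g (I ∷ ls)) k
    + (onPred 0 (λ l′ → ∑[ ls ∈ labellings n k l′ ] g (J ∷ ls)) l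
    + onPred 0 (λ k′ → onPred 0 (λ l′ → ∑[ ls ∈ labellings n k′ l′ ] g (B ∷ ls)) l) k))
∑-labellings-suc n k l g =
  trans (∑-++ (map (N ∷_) (labellings n k l)) _ g)
  (cong₂ _+_ (∑-map (N ∷_) (labellings n k l) g)
  (trans (∑-++ (onPred [] (λ k′ → map (I ∷_) (labellings n k′ l)) k) _ g)
  (cong₂ _+_ (trans (∑-onPred _ k g) (onPred-cong 0 k (λ k′ → ∑-map (I ∷_) (labellings n k′ l) g)))
  (trans (∑-++ (onPred [] (λ l′ → map (J ∷_) (labellings n k l′)) l) _ g)
  (cong₂ _+_ (trans (∑-onPred _ l g) (onPred-cong 0 l (λ l′ → ∑-map (J ∷_) (labellings n k l′) g)))
             (trans (∑-onPred _ k g) (onPred-cong 0 k (λ k′ →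
               trans (∑-onPred _ l g) (onPred-cong 0 l (λ l′ → ∑-map (B ∷_) (labellings n k′ l′) g))))))))))

incSubseq*incSubseq : ∀ bI bJ k l xs →
  incSubseq bI k xs * incSubseq bJ l xs ≡ ∑[ ls ∈ labellings (length xs) k l ] fits bI bJ ls xs
incSubseq*incSubseq bI bJ zero    zero    []       = refl
incSubseq*incSubseq bI bJ zero    (suc l) []       = refl
incSubseq*incSubseq bI bJ (suc k) l       []       = refl
incSubseq*incSubseq bI bJ k       l       (x ∷ xs) = begin
  incSubseq bI k (x ∷ xs) * incSubseq bJ l (x ∷ xs)
    ≡⟨ cong₂ _*_ (incSubseq-∷ bI k x xs) (incSubseq-∷ bJ l x xs) ⟩
  (onPred 0 (new bI) k + incSubseq bI k xs) * (onPred 0 (new bJ) l + incSubseq bJ l xs)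
    ≡⟨ onPred-expand k l (new bI) (new bJ) (incSubseq bI k xs) (incSubseq bJ l xs) ⟩
  incSubseq bI k xs * incSubseq bJ l xs
    + (onPred 0 (λ k′ → new bI k′ * incSubseq bJ l xs) k
    + (onPred 0 (λ l′ → incSubseq bI k xs * new bJ l′) l
    + onPred 0 (λ k′ → onPred 0 (λ l′ → new bI k′ * new bJ l′) l) k))
    ≡⟨ cong₂ _+_ (incSubseq*incSubseq bI bJ k l xs)
       (cong₂ _+_ (onPred-cong 0 k partI)
       (cong₂ _+_ (onPred-cong 0 l partJ)
                  (onPred-cong 0 k (λ k′ → onPred-cong 0 l (partB k′))))) ⟩
  ∑[ ls ∈ labellings m k l ] fitsHere (N ∷ ls)
    + (onPred 0 (λ k′ → ∑[ ls ∈ labellings m k′ l ] fitsHere (I ∷ ls)) k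
    + (onPred 0 (λ l′ → ∑[ ls ∈ labellings m k l′ ] fitsHere (J ∷ ls)) l
    + onPred 0 (λ k′ → onPred 0 (λ l′ → ∑[ ls ∈ labellings m k′ l′ ] fitsHere (B ∷ ls)) l) k))
    ≡⟨ ∑-labellings-suc m k l fitsHere ⟨
  ∑ (labellings (suc m) k l) fitsHere ∎
  where
  m : ℕ
  m = length xs
  fitsHere : List Label → ℕ
  fitsHere ls = fits bI bJ ls (x ∷ xs)
  new : Maybe ℕ → ℕ → ℕ
  new b k′ = if above b x then incSubseq (just x) k′ xs else 0
  partI : ∀ k′ → new bI k′ * incSubseq bJ l xs ≡ ∑[ ls ∈ labellings m k′ l ] fitsHere (I ∷ ls)
  partI k′ = trans (if-float (_* incSubseq bJ l xs) (above bI x))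
    (trans (if-cong-then (above bI x) (incSubseq*incSubseq (just x) bJ k′ l xs))
           (sym (∑-if (labellings m k′ l) (above bI x) _)))
  partJ : ∀ l′ → incSubseq bI k xs * new bJ l′ ≡ ∑[ ls ∈ labellings m k l′ ] fitsHere (J ∷ ls)
  partJ l′ = trans (*-if (incSubseq bI k xs) (above bJ x))
    (trans (if-cong-then (above bJ x) (incSubseq*incSubseq bI (just x) k l′ xs))
           (sym (∑-if (labellings m k l′) (above bJ x) _)))
  partB : ∀ k′ l′ → new bI k′ * new bJ l′ ≡ ∑[ ls ∈ labellings m k′ l′ ] fitsHere (B ∷ ls)
  partB k′ l′ = trans (if-*-if (above bI x) (above bJ x))
    (trans (if-cong-then (above bI x ∧ above bJ x) (incSubseq*incSubseq (just x) (just x) k′ l′ xs))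
           (sym (∑-if (labellings m k′ l′) (above bI x ∧ above bJ x) _)))

-- Summing the weights of all labellings

blockProduct : List ℕ → List ℕ → ℕ
blockProduct α β = product (zipWith (λ a b → multinom2 a b ^ 2) α β)

-- 𝒜 with p blocks instead of j + 1: 𝒜 k l j = 𝒜-blocks k l (suc j) holds by definition.
𝒜-blocks : ℕ → ℕ → ℕ → ℕ
𝒜-blocks k l p = sum (concatMap (λ α → map (blockProduct α) (compositions p l)) (compositions p k))

∑-compositions-suc : ∀ p s (F : List ℕ → ℕ) →
  ∑ (compositions (suc p) s) F ≡ ∑[ a₀ ∈ upTo (suc s) ] ∑[ α ∈ compositions p (s ∸ a₀) ] F (a₀ ∷ α)
∑-compositions-suc p s F = trans (∑-concatMap (λ a₀ → map (a₀ ∷_) (compositions p (s ∸ a₀))) (upTo (suc s)) F)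
  (∑-cong (upTo (suc s)) (λ a₀ → ∑-map (a₀ ∷_) (compositions p (s ∸ a₀)) F))

𝒜-blocks-suc : ∀ a b p →
  𝒜-blocks a b (suc p) ≡ ∑[ a₀ ∈ upTo (suc a) ] ∑[ b₀ ∈ upTo (suc b) ] (multinom2 a₀ b₀ ^ 2 * 𝒜-blocks (a ∸ a₀) (b ∸ b₀) p)
𝒜-blocks-suc a b p = begin
  𝒜-blocks a b (suc p)
    ≡⟨ sum-concatMap (λ α → map (blockProduct α) (compositions (suc p) b)) (compositions (suc p) a) ⟩
  ∑[ α ∈ compositions (suc p) a ] ∑ (compositions (suc p) b) (blockProduct α)
    ≡⟨ ∑-compositions-suc p a (λ α → ∑ (compositions (suc p) b) (blockProduct α)) ⟩
  ∑[ a₀ ∈ upTo (suc a) ] ∑[ α ∈ compositions p (a ∸ a₀) ] ∑ (compositions (suc p) b) (blockProduct (a₀ ∷ α))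
    ≡⟨ ∑-cong (upTo (suc a)) (λ a₀ → ∑-cong (compositions p (a ∸ a₀)) (λ α → peel a₀ α)) ⟩
  ∑[ a₀ ∈ upTo (suc a) ] ∑[ α ∈ compositions p (a ∸ a₀) ] ∑[ b₀ ∈ upTo (suc b) ] (m a₀ b₀ * ∑ (compositions p (b ∸ b₀)) (blockProduct α))
    ≡⟨ ∑-cong (upTo (suc a)) (λ a₀ → ∑-comm (compositions p (a ∸ a₀)) (upTo (suc b)) _) ⟩
  ∑[ a₀ ∈ upTo (suc a) ] ∑[ b₀ ∈ upTo (suc b) ] ∑[ α ∈ compositions p (a ∸ a₀) ] (m a₀ b₀ * ∑ (compositions p (b ∸ b₀)) (blockProduct α))
    ≡⟨ ∑-cong (upTo (suc a)) (λ a₀ → ∑-cong (upTo (suc b)) (λ b₀ → regroup a₀ b₀)) ⟩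
  ∑[ a₀ ∈ upTo (suc a) ] ∑[ b₀ ∈ upTo (suc b) ] (m a₀ b₀ * 𝒜-blocks (a ∸ a₀) (b ∸ b₀) p) ∎
  where
  m : ℕ → ℕ → ℕ
  m a₀ b₀ = multinom2 a₀ b₀ ^ 2
  peel : ∀ a₀ α → ∑ (compositions (suc p) b) (blockProduct (a₀ ∷ α))
                  ≡ ∑[ b₀ ∈ upTo (suc b) ] (m a₀ b₀ * ∑ (compositions p (b ∸ b₀)) (blockProduct α))
  peel a₀ α = trans (∑-compositions-suc p b (blockProduct (a₀ ∷ α)))
    (∑-cong (upTo (suc b)) (λ b₀ → ∑-*ˡ (compositions p (b ∸ b₀)) (m a₀ b₀) (blockProduct α)))
  regroup : ∀ a₀ b₀ → ∑[ α ∈ compositions p (a ∸ a₀) ] (m a₀ b₀ * ∑ (compositions p (b ∸ b₀)) (blockProduct α))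
                      ≡ m a₀ b₀ * 𝒜-blocks (a ∸ a₀) (b ∸ b₀) p
  regroup a₀ b₀ = trans (∑-*ˡ (compositions p (a ∸ a₀)) (m a₀ b₀) _)
    (cong (m a₀ b₀ *_) (sym (sum-concatMap (λ α → map (blockProduct α) (compositions p (b ∸ b₀))) (compositions p (a ∸ a₀)))))

∑-upTo-head : ∀ m (f : ℕ → ℕ) → (∀ i → f (suc i) ≡ 0) → ∑ (upTo (suc m)) f ≡ f 0
∑-upTo-head m f tail≡0 = begin
  ∑ (upTo (suc m)) f          ≡⟨ ∑-upTo-suc m f ⟩
  f 0 + ∑ (upTo m) (f ∘ suc)  ≡⟨ cong (f 0 +_) (trans (∑-cong (upTo m) tail≡0) (∑-0 (upTo m))) ⟩
  f 0 + 0                     ≡⟨ +-identityʳ (f 0) ⟩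
  f 0                         ∎

-- 𝒜 for labellings whose first block already holds α I's and β J's, as in weight α β.
shifted𝒜 : ℕ → ℕ → ℕ → ℕ → ℕ → ℕ
shifted𝒜 α β a b j =
  ∑[ a₀ ∈ upTo (suc a) ] ∑[ b₀ ∈ upTo (suc b) ] (shuffles a₀ b₀ * (shuffles (α + a₀) (β + b₀) * 𝒜-blocks (a ∸ a₀) (b ∸ b₀) j))

shifted𝒜-0-0 : ∀ a b j → shifted𝒜 0 0 a b j ≡ 𝒜-blocks a b (suc j)
shifted𝒜-0-0 a b j = trans (∑-cong (upTo (suc a)) (λ a₀ → ∑-cong (upTo (suc b)) (λ b₀ → square a₀ b₀ _)))
                           (sym (𝒜-blocks-suc a b j))
  where
  square : ∀ a₀ b₀ r → shuffles a₀ b₀ * (shuffles a₀ b₀ * r) ≡ multinom2 a₀ b₀ ^ 2 * r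
  square a₀ b₀ r = begin
    shuffles a₀ b₀ * (shuffles a₀ b₀ * r)   ≡⟨ cong (λ s → s * (s * r)) (shuffles≡multinom2 a₀ b₀) ⟩
    multinom2 a₀ b₀ * (multinom2 a₀ b₀ * r) ≡⟨ solve 2 (λ s r → s :* (s :* r) := s :* (s :* con 1) :* r) refl (multinom2 a₀ b₀) r ⟩
    multinom2 a₀ b₀ ^ 2 * r                 ∎

bothZero : ℕ → ℕ → ℕ
bothZero zero zero = 1
bothZero _    _    = 0

shuffles-split : ∀ a b → shuffles a b ≡ onPred 0 (λ a′ → shuffles a′ b) a + onPred 0 (shuffles a) b + bothZero a b
shuffles-split zero    zero    = refl
shuffles-split zero    (suc b) = refl
shuffles-split (suc a) zero    = sym (trans (+-identityʳ _) (trans (+-identityʳ _) (shuffles-0 a)))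
shuffles-split (suc a) (suc b) = sym (+-identityʳ _)

-- Pascal's rule for the first block: remove its first I, its first J, or (if it is empty) the whole block.
shifted𝒜-rec : ∀ α β a b j →
  shifted𝒜 α β a b j ≡ onPred 0 (λ a′ → shifted𝒜 (suc α) β a′ b j) a + onPred 0 (λ b′ → shifted𝒜 α (suc β) a b′ j) b
                       + shuffles α β * 𝒜-blocks a b j
shifted𝒜-rec α β a b j = begin
  ∑₂ (λ a₀ b₀ → shuffles a₀ b₀ * Q a b a₀ b₀)
    ≡⟨ ∑-cong (upTo (suc a)) (λ a₀ → ∑-cong (upTo (suc b)) (λ b₀ → distrib a₀ b₀)) ⟩
  ∑₂ (λ a₀ b₀ → PI a₀ b₀ * Q a b a₀ b₀ + PJ a₀ b₀ * Q a b a₀ b₀ + bothZero a₀ b₀ * Q a b a₀ b₀)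
    ≡⟨ trans (∑₂-+ (λ a₀ b₀ → PI a₀ b₀ * Q a b a₀ b₀ + PJ a₀ b₀ * Q a b a₀ b₀) (λ a₀ b₀ → bothZero a₀ b₀ * Q a b a₀ b₀))
             (cong (_+ ∑₂ (λ a₀ b₀ → bothZero a₀ b₀ * Q a b a₀ b₀))
                   (∑₂-+ (λ a₀ b₀ → PI a₀ b₀ * Q a b a₀ b₀) (λ a₀ b₀ → PJ a₀ b₀ * Q a b a₀ b₀))) ⟩
  ∑₂ (λ a₀ b₀ → PI a₀ b₀ * Q a b a₀ b₀) + ∑₂ (λ a₀ b₀ → PJ a₀ b₀ * Q a b a₀ b₀) + ∑₂ (λ a₀ b₀ → bothZero a₀ b₀ * Q a b a₀ b₀)
    ≡⟨ cong₂ _+_ (cong₂ _+_ (firstI a) (firstJ b)) emptyBlock ⟩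
  onPred 0 (λ a′ → shifted𝒜 (suc α) β a′ b j) a + onPred 0 (λ b′ → shifted𝒜 α (suc β) a b′ j) b
    + shuffles α β * 𝒜-blocks a b j ∎
  where
  ∑₂ : (ℕ → ℕ → ℕ) → ℕ
  ∑₂ F = ∑[ a₀ ∈ upTo (suc a) ] ∑[ b₀ ∈ upTo (suc b) ] F a₀ b₀
  ∑₂-+ : ∀ F G → ∑₂ (λ a₀ b₀ → F a₀ b₀ + G a₀ b₀) ≡ ∑₂ F + ∑₂ G
  ∑₂-+ F G = trans (∑-cong (upTo (suc a)) (λ a₀ → ∑-+ (upTo (suc b)) (F a₀) (G a₀)))
                   (∑-+ (upTo (suc a)) (λ a₀ → ∑ (upTo (suc b)) (F a₀)) (λ a₀ → ∑ (upTo (suc b)) (G a₀)))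
  Q : ℕ → ℕ → ℕ → ℕ → ℕ
  Q m n a₀ b₀ = shuffles (α + a₀) (β + b₀) * 𝒜-blocks (m ∸ a₀) (n ∸ b₀) j
  PI PJ : ℕ → ℕ → ℕ
  PI a₀ b₀ = onPred 0 (λ a′ → shuffles a′ b₀) a₀
  PJ a₀ b₀ = onPred 0 (shuffles a₀) b₀
  distrib : ∀ a₀ b₀ → shuffles a₀ b₀ * Q a b a₀ b₀ ≡ PI a₀ b₀ * Q a b a₀ b₀ + PJ a₀ b₀ * Q a b a₀ b₀ + bothZero a₀ b₀ * Q a b a₀ b₀
  distrib a₀ b₀ = trans (cong (_* Q a b a₀ b₀) (shuffles-split a₀ b₀))
    (solve 4 (λ p q z r → (p :+ q :+ z) :* r := p :* r :+ q :* r :+ z :* r) refl (PI a₀ b₀) (PJ a₀ b₀) (bothZero a₀ b₀) (Q a b a₀ b₀))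
  firstI : ∀ m → ∑[ a₀ ∈ upTo (suc m) ] ∑[ b₀ ∈ upTo (suc b) ] (PI a₀ b₀ * Q m b a₀ b₀)
                  ≡ onPred 0 (λ a′ → shifted𝒜 (suc α) β a′ b j) m
  firstI zero    = cong (_+ 0) (∑-0 (upTo (suc b)))
  firstI (suc m) = begin
    ∑[ a₀ ∈ upTo (2 + m) ] ∑[ b₀ ∈ upTo (suc b) ] (PI a₀ b₀ * Q (suc m) b a₀ b₀)
      ≡⟨ ∑-upTo-suc (suc m) (λ a₀ → ∑[ b₀ ∈ upTo (suc b) ] (PI a₀ b₀ * Q (suc m) b a₀ b₀)) ⟩
    ∑[ b₀ ∈ upTo (suc b) ] (0 * Q (suc m) b 0 b₀) + ∑[ a₀ ∈ upTo (suc m) ] ∑[ b₀ ∈ upTo (suc b) ] (PI (suc a₀) b₀ * Q (suc m) b (suc a₀) b₀)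
      ≡⟨ cong₂ _+_ (∑-0 (upTo (suc b))) (∑-cong (upTo (suc m)) (λ a₀ → ∑-cong (upTo (suc b)) (λ b₀ →
           cong (λ x → shuffles a₀ b₀ * (shuffles x (β + b₀) * 𝒜-blocks (m ∸ a₀) (b ∸ b₀) j)) (+-suc α a₀)))) ⟩
    shifted𝒜 (suc α) β m b j ∎
  firstJ : ∀ n → ∑[ a₀ ∈ upTo (suc a) ] ∑[ b₀ ∈ upTo (suc n) ] (PJ a₀ b₀ * Q a n a₀ b₀)
                  ≡ onPred 0 (λ b′ → shifted𝒜 α (suc β) a b′ j) n
  firstJ zero    = ∑-0 (upTo (suc a))
  firstJ (suc n) = ∑-cong (upTo (suc a)) (λ a₀ → trans (∑-upTo-suc (suc n) (λ b₀ → PJ a₀ b₀ * Q a (suc n) a₀ b₀)) (∑-cong (upTo (suc n)) (λ b₀ →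
    cong (λ y → shuffles a₀ b₀ * (shuffles (α + a₀) y * 𝒜-blocks (a ∸ a₀) (n ∸ b₀) j)) (+-suc β b₀))))
  emptyBlock : ∑₂ (λ a₀ b₀ → bothZero a₀ b₀ * Q a b a₀ b₀) ≡ shuffles α β * 𝒜-blocks a b j
  emptyBlock = begin
    ∑₂ (λ a₀ b₀ → bothZero a₀ b₀ * Q a b a₀ b₀)
      ≡⟨ ∑-upTo-head a _ (λ _ → ∑-0 (upTo (suc b))) ⟩
    ∑[ b₀ ∈ upTo (suc b) ] (bothZero 0 b₀ * Q a b 0 b₀)
      ≡⟨ ∑-upTo-head b _ (λ _ → refl) ⟩
    1 * Q a b 0 0
      ≡⟨ trans (*-identityˡ (Q a b 0 0)) (cong₂ (λ x y → shuffles x y * 𝒜-blocks a b j) (+-identityʳ α) (+-identityʳ β)) ⟩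
    shuffles α β * 𝒜-blocks a b j ∎

∑diag : (ℕ → ℕ → ℕ → ℕ) → ℕ → ℕ → ℕ
∑diag F (suc k) (suc l) = F 0 (suc k) (suc l) + ∑diag (F ∘ suc) k l
∑diag F zero    l       = F 0 0 l
∑diag F (suc k) zero    = F 0 (suc k) 0

∑diag≡∑upTo : ∀ (F : ℕ → ℕ → ℕ → ℕ) k l → ∑diag F k l ≡ ∑[ j ∈ upTo (suc (k ⊓ l)) ] F j (k ∸ j) (l ∸ j)
∑diag≡∑upTo F (suc k) (suc l) = trans (cong (F 0 (suc k) (suc l) +_) (∑diag≡∑upTo (F ∘ suc) k l))
                                      (sym (∑-upTo-suc (suc (k ⊓ l)) (λ j → F j (suc k ∸ j) (suc l ∸ j))))
∑diag≡∑upTo F zero    l       = sym (+-identityʳ _)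
∑diag≡∑upTo F (suc k) zero    = sym (+-identityʳ _)

∑diag-cong : ∀ {F G : ℕ → ℕ → ℕ → ℕ} k l → (∀ j a b → a + j ≡ k → b + j ≡ l → F j a b ≡ G j a b) →
  ∑diag F k l ≡ ∑diag G k l
∑diag-cong (suc k) (suc l) F≗G = cong₂ _+_ (F≗G 0 (suc k) (suc l) (+-identityʳ _) (+-identityʳ _))
  (∑diag-cong k l (λ j a b a+j≡k b+j≡l → F≗G (suc j) a b (trans (+-suc a j) (cong suc a+j≡k)) (trans (+-suc b j) (cong suc b+j≡l))))
∑diag-cong zero    l       F≗G = F≗G 0 0 l refl (+-identityʳ l)
∑diag-cong (suc k) zero    F≗G = F≗G 0 (suc k) 0 (+-identityʳ _) refl

∑diag-0 : ∀ k l → ∑diag (λ _ _ _ → 0) k l ≡ 0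
∑diag-0 (suc k) (suc l) = ∑diag-0 k l
∑diag-0 zero    l       = refl
∑diag-0 (suc k) zero    = refl

∑diag-+ : ∀ (F G : ℕ → ℕ → ℕ → ℕ) k l → ∑diag (λ j a b → F j a b + G j a b) k l ≡ ∑diag F k l + ∑diag G k l
∑diag-+ F G (suc k) (suc l) =
  trans (cong (F 0 (suc k) (suc l) + G 0 (suc k) (suc l) +_) (∑diag-+ (F ∘ suc) (G ∘ suc) k l))
        (interchange (F 0 (suc k) (suc l)) (G 0 (suc k) (suc l)) (∑diag (F ∘ suc) k l) (∑diag (G ∘ suc) k l))
∑diag-+ F G zero    l       = refl
∑diag-+ F G (suc k) zero    = refl

∑diag-*ˡ : ∀ c (F : ℕ → ℕ → ℕ → ℕ) k l → ∑diag (λ j a b → c * F j a b) k l ≡ c * ∑diag F k l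
∑diag-*ˡ c F (suc k) (suc l) = trans (cong (c * F 0 (suc k) (suc l) +_) (∑diag-*ˡ c (F ∘ suc) k l)) (sym (*-distribˡ-+ c _ _))
∑diag-*ˡ c F zero    l       = refl
∑diag-*ˡ c F (suc k) zero    = refl

∑diag-onPredᵃ : ∀ (G : ℕ → ℕ → ℕ → ℕ) k l → ∑diag (λ j a b → onPred 0 (λ a′ → G j a′ b) a) k l ≡ onPred 0 (λ k′ → ∑diag G k′ l) k
∑diag-onPredᵃ G zero          l       = refl
∑diag-onPredᵃ G (suc zero)    zero    = refl
∑diag-onPredᵃ G (suc (suc k)) zero    = refl
∑diag-onPredᵃ G (suc zero)    (suc l) = +-identityʳ _
∑diag-onPredᵃ G (suc (suc k)) (suc l) = cong (G 0 (suc k) (suc l) +_) (∑diag-onPredᵃ (G ∘ suc) (suc k) l)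

∑diag-onPredᵇ : ∀ (G : ℕ → ℕ → ℕ → ℕ) k l → ∑diag (λ j a b → onPred 0 (λ b′ → G j a b′) b) k l ≡ onPred 0 (λ l′ → ∑diag G k l′) l
∑diag-onPredᵇ G zero          zero          = refl
∑diag-onPredᵇ G zero          (suc l)       = refl
∑diag-onPredᵇ G (suc k)       zero          = refl
∑diag-onPredᵇ G (suc zero)    (suc zero)    = +-identityʳ _
∑diag-onPredᵇ G (suc (suc k)) (suc zero)    = +-identityʳ _
∑diag-onPredᵇ G (suc zero)    (suc (suc l)) = refl
∑diag-onPredᵇ G (suc (suc k)) (suc (suc l)) = cong (G 0 (suc (suc k)) (suc l) +_) (∑diag-onPredᵇ (G ∘ suc) (suc k) (suc l))

∑diag-onPredʲ : ∀ (G : ℕ → ℕ → ℕ → ℕ) k l →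
  ∑diag (λ j a b → onPred 0 (λ j′ → G j′ a b) j) k l ≡ onPred 0 (λ k′ → onPred 0 (λ l′ → ∑diag G k′ l′) l) k
∑diag-onPredʲ G zero    l       = refl
∑diag-onPredʲ G (suc k) zero    = refl
∑diag-onPredʲ G (suc k) (suc l) = refl

chooseWith : ℕ → (ℕ → ℕ) → ℕ → ℕ
chooseWith n h m = (n C m) * h m

chooseWith-pascal : ∀ n h K → chooseWith (suc n) h (suc K) ≡ chooseWith n h (suc K) + chooseWith n (h ∘ suc) K
chooseWith-pascal n h K = begin
  (suc n C suc K) * h (suc K)                    ≡⟨ cong (_* h (suc K)) (nCk+nC[k+1]≡[n+1]C[k+1] n K) ⟨
  (n C K + n C suc K) * h (suc K)                ≡⟨ *-distribʳ-+ (h (suc K)) (n C K) (n C suc K) ⟩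
  (n C K) * h (suc K) + (n C suc K) * h (suc K)  ≡⟨ +-comm ((n C K) * h (suc K)) _ ⟩
  (n C suc K) * h (suc K) + (n C K) * h (suc K)  ∎

-- The contribution of the labellings with j B's to labellingSum α β n (a + j) (b + j) h.
closedTerm : ℕ → ℕ → ℕ → (ℕ → ℕ) → ℕ → ℕ → ℕ → ℕ
closedTerm α β n h j a b = shifted𝒜 α β a b j * chooseWith n h (a + b + j)

onPred-* : ∀ (f c : ℕ → ℕ) k → onPred 0 (λ k′ → f k′ * c (suc k′)) k ≡ onPred 0 f k * c k
onPred-* f c zero    = refl
onPred-* f c (suc k) = refl

*-onPred : ∀ c (f : ℕ → ℕ) k → c * onPred 0 f k ≡ onPred 0 (λ k′ → c * f k′) k
*-onPred c f zero    = *-zeroʳ c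
*-onPred c f (suc k) = refl

-- When a + b + j = suc K, Pascal's rule for (suc n) C (suc K) matches the recurrence of shifted𝒜.
closedTerm-suc-pos : ∀ α β n h j a b K → a + b + j ≡ suc K → 𝒜-blocks a b j ≡ onPred 0 (λ j′ → shifted𝒜 0 0 a b j′) j →
  closedTerm α β (suc n) h j a b
    ≡ closedTerm α β n h j a b + (onPred 0 (λ a′ → closedTerm (suc α) β n (h ∘ suc) j a′ b) a
    + (onPred 0 (λ b′ → closedTerm α (suc β) n (h ∘ suc) j a b′) b
    + shuffles α β * onPred 0 (λ j′ → closedTerm 0 0 n (h ∘ suc) j′ a b) j))
closedTerm-suc-pos α β n h j a b K a+b+j≡1+K 𝒜≡ = begin
  S * chooseWith (suc n) h (a + b + j)
    ≡⟨ cong (λ m → S * chooseWith (suc n) h m) a+b+j≡1+K ⟩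
  S * chooseWith (suc n) h (suc K)
    ≡⟨ cong (S *_) (chooseWith-pascal n h K) ⟩
  S * (chooseWith n h (suc K) + c K)
    ≡⟨ *-distribˡ-+ S _ (c K) ⟩
  S * chooseWith n h (suc K) + S * c K
    ≡⟨ cong₂ (λ m S′ → S * chooseWith n h m + S′ * c K) (sym a+b+j≡1+K)
             (trans (shifted𝒜-rec α β a b j) (cong (λ t → Sᴵ + Sᴶ + shuffles α β * t) 𝒜≡)) ⟩
  closedTerm α β n h j a b + (Sᴵ + Sᴶ + shuffles α β * Sᴮ) * c K
    ≡⟨ cong (closedTerm α β n h j a b +_) (solve 5 (λ x y s z c → (x :+ y :+ s :* z) :* c := x :* c :+ (y :* c :+ s :* (z :* c)))
                                                  refl Sᴵ Sᴶ (shuffles α β) Sᴮ (c K)) ⟩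
  closedTerm α β n h j a b + (Sᴵ * c K + (Sᴶ * c K + shuffles α β * (Sᴮ * c K)))
    ≡⟨ cong (closedTerm α β n h j a b +_) (cong₂ _+_ (sym termA) (cong₂ _+_ (sym termB) (cong (shuffles α β *_) (sym termJ)))) ⟩
  closedTerm α β n h j a b + (onPred 0 (λ a′ → closedTerm (suc α) β n (h ∘ suc) j a′ b) a
    + (onPred 0 (λ b′ → closedTerm α (suc β) n (h ∘ suc) j a b′) b
    + shuffles α β * onPred 0 (λ j′ → closedTerm 0 0 n (h ∘ suc) j′ a b) j)) ∎
  where
  S Sᴵ Sᴶ Sᴮ : ℕ
  S = shifted𝒜 α β a b j
  Sᴵ = onPred 0 (λ a′ → shifted𝒜 (suc α) β a′ b j) a
  Sᴶ = onPred 0 (λ b′ → shifted𝒜 α (suc β) a b′ j) b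
  Sᴮ = onPred 0 (λ j′ → shifted𝒜 0 0 a b j′) j
  c : ℕ → ℕ
  c = chooseWith n (h ∘ suc)
  K≡ : pred (a + b + j) ≡ K
  K≡ = cong pred a+b+j≡1+K
  termA : onPred 0 (λ a′ → closedTerm (suc α) β n (h ∘ suc) j a′ b) a ≡ Sᴵ * c K
  termA = trans (onPred-* (λ a′ → shifted𝒜 (suc α) β a′ b j) (λ a′ → c (pred (a′ + b + j))) a)
                (cong (λ m → Sᴵ * c m) K≡)
  termB : onPred 0 (λ b′ → closedTerm α (suc β) n (h ∘ suc) j a b′) b ≡ Sᴶ * c K
  termB = trans (onPred-cong 0 b (λ b′ → cong (λ m → shifted𝒜 α (suc β) a b′ j * c m) (sym (cong (λ m → pred (m + j)) (+-suc a b′)))))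
          (trans (onPred-* (λ b′ → shifted𝒜 α (suc β) a b′ j) (λ b′ → c (pred (a + b′ + j))) b)
                 (cong (λ m → Sᴶ * c m) K≡))
  termJ : onPred 0 (λ j′ → closedTerm 0 0 n (h ∘ suc) j′ a b) j ≡ Sᴮ * c K
  termJ = trans (onPred-cong 0 j (λ j′ → cong (λ m → shifted𝒜 0 0 a b j′ * c m) (sym (cong pred (+-suc (a + b) j′)))))
          (trans (onPred-* (λ j′ → shifted𝒜 0 0 a b j′) (λ j′ → c (pred (a + b + j′))) j)
                 (cong (λ m → Sᴮ * c m) K≡))

closedTerm-suc : ∀ α β n h j a b →
  closedTerm α β (suc n) h j a b
    ≡ closedTerm α β n h j a b + (onPred 0 (λ a′ → closedTerm (suc α) β n (h ∘ suc) j a′ b) a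
    + (onPred 0 (λ b′ → closedTerm α (suc β) n (h ∘ suc) j a b′) b
    + shuffles α β * onPred 0 (λ j′ → closedTerm 0 0 n (h ∘ suc) j′ a b) j))
closedTerm-suc α β n h zero    zero    zero    =
  sym (trans (cong (closedTerm α β n h 0 0 0 +_) (*-zeroʳ (shuffles α β))) (+-identityʳ _))
closedTerm-suc α β n h zero    (suc a) b       = closedTerm-suc-pos α β n h 0 (suc a) b (a + b + 0) refl refl
closedTerm-suc α β n h zero    zero    (suc b) = closedTerm-suc-pos α β n h 0 0 (suc b) (b + 0) refl refl
closedTerm-suc α β n h (suc j) a       b       =
  closedTerm-suc-pos α β n h (suc j) a b (a + b + j) (+-suc (a + b) j) (sym (shifted𝒜-0-0 a b j))

∑diag-closedTerm-suc : ∀ α β n h k l →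
  ∑diag (closedTerm α β (suc n) h) k l
    ≡ ∑diag (closedTerm α β n h) k l + (onPred 0 (λ k′ → ∑diag (closedTerm (suc α) β n (h ∘ suc)) k′ l) k
    + (onPred 0 (λ l′ → ∑diag (closedTerm α (suc β) n (h ∘ suc)) k l′) l
    + shuffles α β * onPred 0 (λ k′ → onPred 0 (λ l′ → ∑diag (closedTerm 0 0 n (h ∘ suc)) k′ l′) l) k))
∑diag-closedTerm-suc α β n h k l = begin
  ∑diag (closedTerm α β (suc n) h) k l
    ≡⟨ ∑diag-cong k l (λ j a b _ _ → closedTerm-suc α β n h j a b) ⟩
  ∑diag (λ j a b → T₀ j a b + (Tᴵ j a b + (Tᴶ j a b + shuffles α β * Tᴮ j a b))) k l
    ≡⟨ ∑diag-+ T₀ _ k l ⟩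
  ∑diag T₀ k l + ∑diag (λ j a b → Tᴵ j a b + (Tᴶ j a b + shuffles α β * Tᴮ j a b)) k l
    ≡⟨ cong (∑diag T₀ k l +_) (trans (∑diag-+ Tᴵ _ k l) (cong (∑diag Tᴵ k l +_)
         (trans (∑diag-+ Tᴶ _ k l) (cong (∑diag Tᴶ k l +_) (∑diag-*ˡ (shuffles α β) Tᴮ k l))))) ⟩
  ∑diag T₀ k l + (∑diag Tᴵ k l + (∑diag Tᴶ k l + shuffles α β * ∑diag Tᴮ k l))
    ≡⟨ cong (∑diag T₀ k l +_) (cong₂ _+_ (∑diag-onPredᵃ (closedTerm (suc α) β n (h ∘ suc)) k l)
         (cong₂ _+_ (∑diag-onPredᵇ (closedTerm α (suc β) n (h ∘ suc)) k l)
                    (cong (shuffles α β *_) (∑diag-onPredʲ (closedTerm 0 0 n (h ∘ suc)) k l)))) ⟩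
  ∑diag (closedTerm α β n h) k l + (onPred 0 (λ k′ → ∑diag (closedTerm (suc α) β n (h ∘ suc)) k′ l) k
    + (onPred 0 (λ l′ → ∑diag (closedTerm α (suc β) n (h ∘ suc)) k l′) l
    + shuffles α β * onPred 0 (λ k′ → onPred 0 (λ l′ → ∑diag (closedTerm 0 0 n (h ∘ suc)) k′ l′) l) k)) ∎
  where
  T₀ Tᴵ Tᴶ Tᴮ : ℕ → ℕ → ℕ → ℕ
  T₀ = closedTerm α β n h
  Tᴵ j a b = onPred 0 (λ a′ → closedTerm (suc α) β n (h ∘ suc) j a′ b) a
  Tᴶ j a b = onPred 0 (λ b′ → closedTerm α (suc β) n (h ∘ suc) j a b′) b
  Tᴮ j a b = onPred 0 (λ j′ → closedTerm 0 0 n (h ∘ suc) j′ a b) j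

labellingSum : ℕ → ℕ → ℕ → ℕ → ℕ → (ℕ → ℕ) → ℕ
labellingSum α β n k l h = ∑[ ls ∈ labellings n k l ] (weight α β ls * h (∑ ls inSome))

labellingSum-suc : ∀ α β n k l h →
  labellingSum α β (suc n) k l h
    ≡ labellingSum α β n k l h + (onPred 0 (λ k′ → labellingSum (suc α) β n k′ l (h ∘ suc)) k
    + (onPred 0 (λ l′ → labellingSum α (suc β) n k l′ (h ∘ suc)) l
    + shuffles α β * onPred 0 (λ k′ → onPred 0 (λ l′ → labellingSum 0 0 n k′ l′ (h ∘ suc)) l) k))
labellingSum-suc α β n k l h =
  trans (∑-labellings-suc n k l (λ ls → weight α β ls * h (∑ ls inSome)))
        (cong (λ t → labellingSum α β n k l h + (onPred 0 (λ k′ → labellingSum (suc α) β n k′ l (h ∘ suc)) k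
                      + (onPred 0 (λ l′ → labellingSum α (suc β) n k l′ (h ∘ suc)) l + t)))
              (trans (onPred-cong 0 k (λ k′ → onPred-cong 0 l (λ l′ → sumB k′ l′)))
                     (trans (onPred-cong 0 k (λ k′ → sym (*-onPred (shuffles α β) _ l))) (sym (*-onPred (shuffles α β) _ k)))))
  where
  sumB : ∀ k′ l′ → ∑[ ls ∈ labellings n k′ l′ ] (weight α β (B ∷ ls) * h (∑ (B ∷ ls) inSome))
                   ≡ shuffles α β * labellingSum 0 0 n k′ l′ (h ∘ suc)
  sumB k′ l′ = trans (∑-cong (labellings n k′ l′) (λ ls → *-assoc (shuffles α β) (weight 0 0 ls) _))
                     (∑-*ˡ (labellings n k′ l′) (shuffles α β) _)

closedTerm-0 : ∀ α β h j a b → 0 < a + b + j → closedTerm α β 0 h j a b ≡ 0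
closedTerm-0 α β h j a b pos with a + b + j
... | suc m = *-zeroʳ (shifted𝒜 α β a b j)

labellingSum≡∑diag : ∀ n α β k l h → labellingSum α β n k l h ≡ ∑diag (closedTerm α β n h) k l
labellingSum≡∑diag zero α β zero zero h =
  trans (+-identityʳ _) (cong₂ _*_ (sym (trans (shifted𝒜-rec α β 0 0 0) (*-identityʳ (shuffles α β)))) (sym (*-identityˡ (h 0))))
labellingSum≡∑diag zero α β (suc k) l h =
  sym (trans (∑diag-cong (suc k) l (λ j a b a+j≡1+k _ → closedTerm-0 α β h j a b (positive {a} {b} {j} a+j≡1+k))) (∑diag-0 (suc k) l))
  where
  positive : ∀ {a b j} → a + j ≡ suc k → 0 < a + b + j
  positive {a} {b} {j} a+j≡1+k = <-≤-trans (subst (0 <_) (sym a+j≡1+k) (s≤s z≤n)) (+-monoˡ-≤ j (m≤m+n a b))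
labellingSum≡∑diag zero α β zero (suc l) h =
  sym (trans (∑diag-cong 0 (suc l) (λ j a b _ b+j≡1+l → closedTerm-0 α β h j a b (positive {a} {b} {j} b+j≡1+l))) (∑diag-0 0 (suc l)))
  where
  positive : ∀ {a b j} → b + j ≡ suc l → 0 < a + b + j
  positive {a} {b} {j} b+j≡1+l = <-≤-trans (subst (0 <_) (sym b+j≡1+l) (s≤s z≤n)) (+-monoˡ-≤ j (m≤n+m b a))
labellingSum≡∑diag (suc n) α β k l h = begin
  labellingSum α β (suc n) k l h
    ≡⟨ labellingSum-suc α β n k l h ⟩
  labellingSum α β n k l h + (onPred 0 (λ k′ → labellingSum (suc α) β n k′ l (h ∘ suc)) k
    + (onPred 0 (λ l′ → labellingSum α (suc β) n k l′ (h ∘ suc)) l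
    + shuffles α β * onPred 0 (λ k′ → onPred 0 (λ l′ → labellingSum 0 0 n k′ l′ (h ∘ suc)) l) k))
    ≡⟨ cong₂ _+_ (labellingSum≡∑diag n α β k l h)
       (cong₂ _+_ (onPred-cong 0 k (λ k′ → labellingSum≡∑diag n (suc α) β k′ l (h ∘ suc)))
       (cong₂ _+_ (onPred-cong 0 l (λ l′ → labellingSum≡∑diag n α (suc β) k l′ (h ∘ suc)))
                  (cong (shuffles α β *_) (onPred-cong 0 k (λ k′ → onPred-cong 0 l (λ l′ → labellingSum≡∑diag n 0 0 k′ l′ (h ∘ suc))))))) ⟩
  ∑diag (closedTerm α β n h) k l + (onPred 0 (λ k′ → ∑diag (closedTerm (suc α) β n (h ∘ suc)) k′ l) k
    + (onPred 0 (λ l′ → ∑diag (closedTerm α (suc β) n (h ∘ suc)) k l′) l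
    + shuffles α β * onPred 0 (λ k′ → onPred 0 (λ l′ → ∑diag (closedTerm 0 0 n (h ∘ suc)) k′ l′) l) k))
    ≡⟨ ∑diag-closedTerm-suc α β n h k l ⟨
  ∑diag (closedTerm α β (suc n) h) k l ∎

-- Permutations with an increasing prefix

fits-IorN-bound : ∀ ρ → All IorN ρ → ∀ bI bJ bJ′ xs → fits bI bJ ρ xs ≡ fits bI bJ′ ρ xs
fits-IorN-bound []      []          bI bJ bJ′ xs       = refl
fits-IorN-bound (_ ∷ ρ) _           bI bJ bJ′ []       = refl
fits-IorN-bound (I ∷ ρ) (iI ∷ inρ)  bI bJ bJ′ (x ∷ xs) = if-cong-then (above bI x) (fits-IorN-bound ρ inρ (just x) bJ bJ′ xs)
fits-IorN-bound (N ∷ ρ) (iN ∷ inρ)  bI bJ bJ′ (x ∷ xs) = fits-IorN-bound ρ inρ bI bJ bJ′ xs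

-- Compare the labellings N ∷ ρ and J ∷ ρ with ρ = IᵏNᵐ: they fit the same permutations,
-- while their weights are shuffles(k, 0) = 1 and shuffles(k, 1) = k + 1.
incPrefixCount-suc : ∀ n k → suc k ≤ n → incPrefixCount n k ≡ suc k * incPrefixCount n (suc k)
incPrefixCount-suc n k k<n = begin
  incPrefixCount n k                               ≡⟨ *-identityˡ (incPrefixCount n k) ⟨
  1 * incPrefixCount n k                           ≡⟨ cong₂ (λ w m → w * incPrefixCount n m) (trans (weightρ 0) (shuffles-0 k)) #inSome ⟨
  weight 0 0 ρ * incPrefixCount n (∑ ρ inSome)     ≡⟨ fitCount-weight _ n [] (N ∷ ρ) ≤-refl [] lengthρ ⟨
  fitCount n (N ∷ ρ)                               ≡⟨ sumPerm-cong n (λ π _ → N∼J (values π)) ⟩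
  fitCount n (J ∷ ρ)                               ≡⟨ fitCount-weight _ n [] (J ∷ ρ) ≤-refl [] lengthρ ⟩
  weight 0 1 ρ * incPrefixCount n (suc (∑ ρ inSome)) ≡⟨ cong₂ (λ w m → w * incPrefixCount n (suc m)) (trans (weightρ 1) (shuffles-1 k)) #inSome ⟩
  suc k * incPrefixCount n (suc k)                 ∎
  where
  m : ℕ
  m = n ∸ suc k
  ρ : List Label
  ρ = replicate k I ++ replicate m N
  IorNρ : All IorN ρ
  IorNρ = ++⁺ (Is k) (Ns m)
    where
    Is : ∀ i → All IorN (replicate i I)
    Is zero    = []
    Is (suc i) = iI ∷ Is i
    Ns : ∀ i → All IorN (replicate i N)
    Ns zero    = []
    Ns (suc i) = iN ∷ Ns i
  lengthρ : suc (length ρ) ≡ n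
  lengthρ = trans (cong suc (trans (length-++ (replicate k I)) (cong₂ _+_ (length-replicate k) (length-replicate m)))) (m+[n∸m]≡n k<n)
  ∑ρ : ∀ (p : Label → ℕ) → ∑ ρ p ≡ k * p I + m * p N
  ∑ρ p = trans (∑-++ (replicate k I) (replicate m N) p) (cong₂ _+_ (∑-replicate p k I) (∑-replicate p m N))
  #inSome : ∑ ρ inSome ≡ k
  #inSome = trans (∑ρ inSome) (trans (cong₂ _+_ (*-identityʳ k) (*-zeroʳ m)) (+-identityʳ k))
  #I : ∑ ρ isI ≡ k
  #I = trans (∑ρ isI) (trans (cong₂ _+_ (*-identityʳ k) (*-zeroʳ m)) (+-identityʳ k))
  weightρ : ∀ β → weight 0 β ρ ≡ shuffles k β
  weightρ β = begin
    weight 0 β ρ            ≡⟨ cong (weight 0 β) (++-identityʳ ρ) ⟨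
    weight 0 β (ρ ++ [])    ≡⟨ weight-IorN-prefix 0 β ρ [] IorNρ ⟩
    shuffles (∑ ρ isI + 0) β ≡⟨ cong (λ a → shuffles a β) (trans (+-identityʳ _) #I) ⟩
    shuffles k β            ∎
  N∼J : ∀ xs → fits nothing nothing (N ∷ ρ) xs ≡ fits nothing nothing (J ∷ ρ) xs
  N∼J []       = refl
  N∼J (x ∷ xs) = fits-IorN-bound ρ IorNρ nothing nothing (just x) xs

∑-allFin : ∀ n (g : ℕ → ℕ) → ∑[ i ∈ allFin n ] g (toℕ i) ≡ ∑ (upTo n) g
∑-allFin n g = trans (cong sum (map-tabulate {n = n} (λ i → i) (g ∘ toℕ))) (sum-tabulate n g)
  where
  sum-tabulate : ∀ n (g : ℕ → ℕ) → sum (tabulate {n = n} (g ∘ toℕ)) ≡ ∑ (upTo n) g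
  sum-tabulate zero    g = refl
  sum-tabulate (suc n) g = trans (cong (g 0 +_) (sum-tabulate n (g ∘ suc))) (sym (∑-upTo-suc n g))

excluded : Maybe ℕ → ℕ
excluded nothing  = 0
excluded (just c) = suc c

hockey-stick : ∀ n b m → ∑[ i ∈ upTo n ] (if above b i then (n ∸ suc i) C m else 0) ≡ (n ∸ excluded b) C suc m
hockey-stick zero    nothing        m = refl
hockey-stick zero    (just c)       m = refl
hockey-stick (suc n) nothing        m =
  trans (∑-upTo-suc n (λ i → (n ∸ i) C m)) (trans (cong (n C m +_) (hockey-stick n nothing m)) (nCk+nC[k+1]≡[n+1]C[k+1] n m))
hockey-stick (suc n) (just zero)    m = trans (∑-upTo-suc n (λ i → if 0 <ᵇ i then (n ∸ i) C m else 0)) (hockey-stick n nothing m)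
hockey-stick (suc n) (just (suc c)) m =
  trans (∑-upTo-suc n (λ i → if suc c <ᵇ i then (n ∸ i) C m else 0)) (hockey-stick n (just c) m)

count-increasing : ∀ n m b → ∑[ v ∈ allVec n m ] fits b b (replicate m B) (values v) ≡ (n ∸ excluded b) C m
count-increasing n zero    b = refl
count-increasing n (suc m) b = begin
  ∑[ v ∈ allVec n (suc m) ] fits b b (replicate (suc m) B) (values v)
    ≡⟨ ∑-allVec-suc {n} (λ v → fits b b (replicate (suc m) B) (values v)) ⟩
  ∑[ x ∈ allFin n ] ∑[ v ∈ allVec n m ] (if above b (toℕ x) ∧ above b (toℕ x) then rest (toℕ x) v else 0)
    ≡⟨ ∑-cong (allFin n) (λ x → trans (∑-if (allVec n m) (above b (toℕ x) ∧ above b (toℕ x)) (rest (toℕ x)))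
                                (trans (if-cong (∧-idem (above b (toℕ x))))
                                       (if-cong-then (above b (toℕ x)) (count-increasing n m (just (toℕ x)))))) ⟩
  ∑[ x ∈ allFin n ] (if above b (toℕ x) then (n ∸ suc (toℕ x)) C m else 0)
    ≡⟨ ∑-allFin n (λ i → if above b i then (n ∸ suc i) C m else 0) ⟩
  ∑[ i ∈ upTo n ] (if above b i then (n ∸ suc i) C m else 0)
    ≡⟨ hockey-stick n b m ⟩
  (n ∸ excluded b) C suc m ∎
  where
  rest : ℕ → Vec (Fin n) m → ℕ
  rest x v = fits (just x) (just x) (replicate m B) (values v)

increasing⇒distinct : ∀ {n} m b (v : Vec (Fin n) m) →
  fits b b (replicate m B) (values v) ≡ 0 ⊎ (AllPairs _≢_ (toList v) × All (λ y → above b (toℕ y) ≡ true) (toList v))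
increasing⇒distinct zero    b V.[]        = inj₂ ([] , [])
increasing⇒distinct (suc m) b (x V.∷ v) with above b (toℕ x) in bx
... | false = inj₁ refl
... | true with increasing⇒distinct m (just (toℕ x)) v
...   | inj₁ fits≡0           = inj₁ fits≡0
...   | inj₂ (distinct , x<v) =
  inj₂ ( All.map (λ {y} x<y x≡y → <-irrefl (cong toℕ x≡y) (<ᵇ≡true⇒< {toℕ x} {toℕ y} x<y)) x<v ∷ distinct
       , bx ∷ All.map (λ {y} x<y → above-< b bx (<ᵇ≡true⇒< {toℕ x} {toℕ y} x<y)) x<v)

incPrefixCount-n : ∀ n → incPrefixCount n n ≡ 1
incPrefixCount-n n = begin
  incPrefixCount n n
    ≡⟨ cong (λ m → fitCount n (replicate n B ++ replicate m N)) (n∸n≡0 n) ⟩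
  fitCount n (replicate n B ++ [])
    ≡⟨ cong (fitCount n) (++-identityʳ (replicate n B)) ⟩
  fitCount n (replicate n B)
    ≡⟨ sumPerm≡∑allVec {n} (λ π → fits nothing nothing (replicate n B) (values π)) ⟩
  ∑[ v ∈ allVec n n ] (if does (isPerm? v) then fits nothing nothing (replicate n B) (values v) else 0)
    ≡⟨ ∑-cong (allVec n n) increasing-are-perms ⟩
  ∑[ v ∈ allVec n n ] fits nothing nothing (replicate n B) (values v)
    ≡⟨ count-increasing n n nothing ⟩
  n C n
    ≡⟨ nCn≡1 n ⟩
  1 ∎
  where
  increasing-are-perms : ∀ v → (if does (isPerm? v) then fits nothing nothing (replicate n B) (values v) else 0)
                               ≡ fits nothing nothing (replicate n B) (values v)
  increasing-are-perms v with isPerm? v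
  ... | yes _     = refl
  ... | no ¬isPerm with increasing⇒distinct n nothing v
  ...   | inj₁ fits≡0           = sym fits≡0
  ...   | inj₂ (distinct , _)   = ⊥-elim (¬isPerm distinct)

incPrefixCount-! : ∀ n k → k ≤ n → k ! * incPrefixCount n k ≡ n !
incPrefixCount-! n k k≤n = begin
  k ! * incPrefixCount n k          ≡⟨ telescope k k≤n ⟨
  incPrefixCount n 0                ≡⟨ telescope n ≤-refl ⟩
  n ! * incPrefixCount n n          ≡⟨ cong (n ! *_) (incPrefixCount-n n) ⟩
  n ! * 1                           ≡⟨ *-identityʳ (n !) ⟩
  n !                               ∎
  where
  telescope : ∀ k → k ≤ n → incPrefixCount n 0 ≡ k ! * incPrefixCount n k
  telescope zero    _   = sym (+-identityʳ _)
  telescope (suc k) k<n = begin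
    incPrefixCount n 0                                ≡⟨ telescope k (<⇒≤ k<n) ⟩
    k ! * incPrefixCount n k                          ≡⟨ cong (k ! *_) (incPrefixCount-suc n k k<n) ⟩
    k ! * (suc k * incPrefixCount n (suc k))          ≡⟨ solve 3 (λ f s t → f :* (s :* t) := s :* f :* t) refl (k !) (suc k) (incPrefixCount n (suc k)) ⟩
    suc k * k ! * incPrefixCount n (suc k)            ∎

sumPerm-Z*Z : ∀ n k l → sumPerm n (λ π → Z k π * Z l π) ≡ ∑diag (closedTerm 0 0 n (incPrefixCount n)) k l
sumPerm-Z*Z n k l = begin
  sumPerm n (λ π → Z k π * Z l π)
    ≡⟨ ∑-cong (Sym n) (λ π → trans (incSubseq*incSubseq nothing nothing k l (values π))
                                   (cong (λ m → ∑[ ls ∈ labellings m k l ] fits nothing nothing ls (values π))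
                                         (length-toList (V.map toℕ π)))) ⟩
  ∑[ π ∈ Sym n ] ∑[ ls ∈ labellings n k l ] fits nothing nothing ls (values π)
    ≡⟨ ∑-comm (Sym n) (labellings n k l) (λ π ls → fits nothing nothing ls (values π)) ⟩
  ∑[ ls ∈ labellings n k l ] fitCount n ls
    ≡⟨ ∑-cong-All (All.map (λ {ls} len → fitCount-weight (∑ ls inOne) n [] ls ≤-refl [] len) (labellings-length n k l)) ⟩
  labellingSum 0 0 n k l (incPrefixCount n)
    ≡⟨ labellingSum≡∑diag n 0 0 k l (incPrefixCount n) ⟩
  ∑diag (closedTerm 0 0 n (incPrefixCount n)) k l ∎

∑diag-zeroʳ : ∀ (F : ℕ → ℕ → ℕ → ℕ) k → ∑diag F k 0 ≡ F 0 k 0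
∑diag-zeroʳ F zero    = refl
∑diag-zeroʳ F (suc k) = refl

shifted𝒜-no-J : ∀ α a → shifted𝒜 α 0 a 0 0 ≡ 1
shifted𝒜-no-J α zero    = trans (shifted𝒜-rec α 0 0 0 0) (trans (*-identityʳ (shuffles α 0)) (shuffles-0 α))
shifted𝒜-no-J α (suc a) = trans (shifted𝒜-rec α 0 (suc a) 0 0)
  (trans (cong (λ s → s + 0 + shuffles α 0 * 0) (shifted𝒜-no-J (suc α) a)) (cong suc (*-zeroʳ (shuffles α 0))))

sumPerm-Z : ∀ n u → sumPerm n (Z u) ≡ (n C u) * incPrefixCount n u
sumPerm-Z n u = begin
  sumPerm n (Z u)                                   ≡⟨ ∑-cong (Sym n) (λ π → sym (*-identityʳ (Z u π))) ⟩
  sumPerm n (λ π → Z u π * Z 0 π)                   ≡⟨ sumPerm-Z*Z n u 0 ⟩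
  ∑diag (closedTerm 0 0 n (incPrefixCount n)) u 0   ≡⟨ ∑diag-zeroʳ (closedTerm 0 0 n (incPrefixCount n)) u ⟩
  shifted𝒜 0 0 u 0 0 * chooseWith n (incPrefixCount n) (u + 0 + 0)
    ≡⟨ cong₂ _*_ (shifted𝒜-no-J 0 u) (cong (chooseWith n (incPrefixCount n)) (trans (+-identityʳ (u + 0)) (+-identityʳ u))) ⟩
  1 * chooseWith n (incPrefixCount n) u             ≡⟨ *-identityˡ _ ⟩
  (n C u) * incPrefixCount n u                      ∎

+-∸-diag : ∀ a b j → a + j + (b + j) ∸ j ≡ a + b + j
+-∸-diag a b j = trans (cong (_∸ j) (solve 3 (λ a b j → a :+ j :+ (b :+ j) := a :+ b :+ j :+ j) refl a b j)) (m+n∸n≡m (a + b + j) j)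

proposition2p1 : (n : ℕ) → 1 ≤ n →
    ((k : ℕ) → 1 ≤ k → k ≤ n →
      k ! * sumPerm n (Z k) ≡ n ! * (n C k))
    × ((k ℓ : ℕ) → 1 ≤ k → k ≤ n → 1 ≤ ℓ → ℓ ≤ n →
      sumPerm n (λ π → Z k π * Z ℓ π)
        ≡ sum (map (λ j → sumPerm n (Z (k + ℓ ∸ j)) * 𝒜 (k ∸ j) (ℓ ∸ j) j) (upTo (suc (k ⊓ ℓ)))))
proposition2p1 n _ = first-moment , second-moment
  where
  first-moment : (k : ℕ) → 1 ≤ k → k ≤ n → k ! * sumPerm n (Z k) ≡ n ! * (n C k)
  first-moment k _ k≤n = begin
    k ! * sumPerm n (Z k)                   ≡⟨ cong (k ! *_) (sumPerm-Z n k) ⟩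
    k ! * ((n C k) * incPrefixCount n k)    ≡⟨ *-exchange (k !) (n C k) (incPrefixCount n k) ⟩
    (n C k) * (k ! * incPrefixCount n k)    ≡⟨ cong ((n C k) *_) (incPrefixCount-! n k k≤n) ⟩
    (n C k) * n !                           ≡⟨ *-comm (n C k) (n !) ⟩
    n ! * (n C k)                           ∎
  second-moment : (k ℓ : ℕ) → 1 ≤ k → k ≤ n → 1 ≤ ℓ → ℓ ≤ n →
    sumPerm n (λ π → Z k π * Z ℓ π) ≡ sum (map (λ j → sumPerm n (Z (k + ℓ ∸ j)) * 𝒜 (k ∸ j) (ℓ ∸ j) j) (upTo (suc (k ⊓ ℓ))))
  second-moment k ℓ _ _ _ _ = begin
    sumPerm n (λ π → Z k π * Z ℓ π)                            ≡⟨ sumPerm-Z*Z n k ℓ ⟩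
    ∑diag (closedTerm 0 0 n (incPrefixCount n)) k ℓ            ≡⟨ ∑diag-cong k ℓ term ⟩
    ∑diag (λ j a b → sumPerm n (Z (k + ℓ ∸ j)) * 𝒜 a b j) k ℓ  ≡⟨ ∑diag≡∑upTo (λ j a b → sumPerm n (Z (k + ℓ ∸ j)) * 𝒜 a b j) k ℓ ⟩
    ∑[ j ∈ upTo (suc (k ⊓ ℓ)) ] (sumPerm n (Z (k + ℓ ∸ j)) * 𝒜 (k ∸ j) (ℓ ∸ j) j) ∎
    where
    term : ∀ j a b → a + j ≡ k → b + j ≡ ℓ → closedTerm 0 0 n (incPrefixCount n) j a b ≡ sumPerm n (Z (k + ℓ ∸ j)) * 𝒜 a b j
    term j a b refl refl = begin
      shifted𝒜 0 0 a b j * chooseWith n (incPrefixCount n) (a + b + j)  ≡⟨ cong₂ _*_ (shifted𝒜-0-0 a b j) (sym (sumPerm-Z n (a + b + j))) ⟩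
      𝒜 a b j * sumPerm n (Z (a + b + j))                               ≡⟨ *-comm (𝒜 a b j) _ ⟩
      sumPerm n (Z (a + b + j)) * 𝒜 a b j                               ≡⟨ cong (λ m → sumPerm n (Z m) * 𝒜 a b j) (+-∸-diag a b j) ⟨
      sumPerm n (Z (a + j + (b + j) ∸ j)) * 𝒜 a b j                     ∎
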